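{- Let $\sigma(n)$ denote the sum of the positive divisors of $n$, and define the sequence $(\sigma_{inv}(n))_{n\ge 0}$ as the convolution inverse of $(\sigma(n+1))_{n\ge 0}$, i.e. \[ \sum_{k=0}^n\sigma(k+1)\sigma_{inv}(n-k)=\begin{cases}1,& n=0,\\ 0,& n>0.\end{cases} \] Then $\sigma_{inv}(n)\equiv 0\pmod 5$ for every integer $n>1$ with $n\not\equiv 0\pmod 5$. -}

module Defs where

open import Data.Nat using (ℕ; zero; suc; _∸_)
open import Data.Nat.Divisibility using (_∣?_)
open import Data.Nat.ListAction using (sum)
open import Data.List using (List; filter; upTo; map)
open import Data.Integer using (ℤ; +_; _+_; _*_)

σ : ℕ → ℕ
σ n = sum (filter (_∣? n) (map suc (upTo n)))

conv : (ℕ → ℤ) → ℕ → ℤ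
conv s n = go n n
  where
  go : ℕ → ℕ → ℤ
  go zero    m = + σ 1 * s m
  go (suc i) m = go i m + (+ σ (suc (suc i))) * s (m ∸ suc i)

δ : ℕ → ℤ
δ zero    = + 1
δ (suc _) = + 0

{-# OPTIONS --safe #-}
module Submission where

-- With θ = q d/dq, J = Σₖ (-1)ᵏ (2k+1) q^(k(k+1)/2) and s = Σₘ σ(m) qᵐ: Jacobi's identity
-- ∏ₙ (1 - qⁿ)³ = J follows from its finite form Σₖ (-1)ᵏ (2k+1) q^(k(k+1)/2) [2n+1, n+1+k]_q = (q; q)ₙ²
-- (induction on n via the q-Pascal rules), because [2n+1, n+1+k]_q (q; q)ₙ ≡ 1 modulo q^(n+1-k).
-- As θ log ∏ₙ (1 - qⁿ) = -s, it gives θJ = -3 s J, that is Σⱼ σinv(j) (n+1-j) J_(n+1-j) = -3 J_n.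
-- Modulo 5, J lives on exponents ≡ 0, 1 (a triangular number is ≡ 3 only when 5 ∣ 2k+1, which then
-- divides the coefficient), so (m+1) J_(m+1) ≡ 0 unless 5 ∣ m, and (n-1) J_n ≡ 0 unless 5 ∣ n. By
-- strong induction all terms of the sum vanish modulo 5 except those with σinv(n) and σinv(1) = -3,
-- which leaves 3 σinv(n) ≡ -3 (n-1) J_n ≡ 0.

open import Defs
open import Data.Nat as ℕ using (ℕ; zero; suc; _<_; _≤_; z≤n; s≤s; _∸_; _%_)
import Data.Nat.Properties as ℕ
import Data.Nat.Divisibility as ℕ
open import Data.Nat.Induction using (<-rec)
open import Data.Nat.ListAction using (sum)
import Data.Nat.ListAction.Properties as ℕ
import Data.Nat.Tactic.RingSolver as NatSolver
open import Data.List using ([]; [_]; _++_; filter; upTo; map)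
import Data.List.Properties as List
open import Data.Integer as ℤ using (ℤ; +_; 0ℤ; 1ℤ; -1ℤ; _+_; _-_; _*_; -_; _^_)
import Data.Integer.Properties as ℤ
import Data.Integer.Divisibility.Signed as Signed
open import Data.Integer.Tactic.RingSolver using (solve-∀)
open import Data.Maybe using (Maybe; just; nothing)
open import Data.Product using (_,_)
open import Data.Sum using (_⊎_; inj₁; inj₂)
open import Data.Empty using (⊥-elim)
open import Function using (_∘_)
open import Level using (0ℓ)
open import Relation.Binary.PropositionalEquality as ≡ using (_≡_; _≢_; refl; cong; cong₂; sym; trans)
open import Relation.Binary.Structures using (IsEquivalence)
import Relation.Binary.Reasoning.Setoid as SetoidReasoning
open import Relation.Nullary using (¬_; yes; no)
open import Relation.Nullary.Negation using (contradiction)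
open import Algebra.Bundles using (CommutativeRing; RawRing)
open import Algebra.Structures using (IsCommutativeRing)
open import Algebra.Solver.Ring.AlmostCommutativeRing
  using (AlmostCommutativeRing; fromCommutativeRing; _-Raw-AlmostCommutative⟶_)

-- Formal power series

Series : Set
Series = ℕ → ℤ

infix 4 _≈_
_≈_ : Series → Series → Set
f ≈ g = ∀ n → f n ≡ g n

≈-isEquivalence : IsEquivalence _≈_
≈-isEquivalence = record
  { refl  = λ _ → refl
  ; sym   = λ f≈g n → sym (f≈g n)
  ; trans = λ f≈g g≈h n → trans (f≈g n) (g≈h n)
  }

open IsEquivalence ≈-isEquivalence using () renaming (refl to ≈-refl; sym to ≈-sym; trans to ≈-trans)

infixl 6 _⊕_
infixl 7 _⊛_
infixr 8 _∙_
infix  8 ⊖_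

_⊕_ : Series → Series → Series
(f ⊕ g) n = f n + g n

⊖_ : Series → Series
(⊖ f) n = - f n

_∙_ : ℤ → Series → Series
(c ∙ f) n = c * f n

⟪_⟫ : ℤ → Series
⟪ c ⟫ zero    = c
⟪ c ⟫ (suc _) = 0ℤ

𝟘 𝟙 : Series
𝟘 _ = 0ℤ
𝟙 = ⟪ 1ℤ ⟫

_⊛_ : Series → Series → Series
(f ⊛ g) zero    = f 0 * g 0
(f ⊛ g) (suc n) = f 0 * g (suc n) + ((f ∘ suc) ⊛ g) n

⊛-cong : ∀ {f f′ g g′} → f ≈ f′ → g ≈ g′ → f ⊛ g ≈ f′ ⊛ g′
⊛-cong f≈ g≈ zero    = cong₂ _*_ (f≈ 0) (g≈ 0)
⊛-cong f≈ g≈ (suc n) = cong₂ _+_ (cong₂ _*_ (f≈ 0) (g≈ (suc n))) (⊛-cong (f≈ ∘ suc) g≈ n)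

⊛-distribʳ : ∀ h f g → (f ⊕ g) ⊛ h ≈ f ⊛ h ⊕ g ⊛ h
⊛-distribʳ h f g zero    = ℤ.*-distribʳ-+ (h 0) (f 0) (g 0)
⊛-distribʳ h f g (suc n) =
  trans (cong (_+_ ((f 0 + g 0) * h (suc n))) (⊛-distribʳ h (f ∘ suc) (g ∘ suc) n))
        (interchange (f 0) (g 0) (h (suc n)) _ _)
  where
  interchange : ∀ x y z u v → (x + y) * z + (u + v) ≡ x * z + u + (y * z + v)
  interchange = solve-∀

∙-⊛ : ∀ c f g → (c ∙ f) ⊛ g ≈ c ∙ (f ⊛ g)
∙-⊛ c f g zero    = ℤ.*-assoc c (f 0) (g 0)
∙-⊛ c f g (suc n) =
  trans (cong (_+_ (c * f 0 * g (suc n))) (∙-⊛ c (f ∘ suc) g n)) (factor c (f 0) _ _)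
  where
  factor : ∀ c x z u → c * x * z + c * u ≡ c * (x * z + u)
  factor = solve-∀

⊛-assoc : ∀ f g h → (f ⊛ g) ⊛ h ≈ f ⊛ (g ⊛ h)
⊛-assoc f g h zero    = ℤ.*-assoc (f 0) (g 0) (h 0)
⊛-assoc f g h (suc n) = begin
    f 0 * g 0 * h (suc n) + ((f 0 ∙ (g ∘ suc) ⊕ (f ∘ suc) ⊛ g) ⊛ h) n
  ≡⟨ cong (_+_ (f 0 * g 0 * h (suc n))) (⊛-distribʳ h (f 0 ∙ (g ∘ suc)) ((f ∘ suc) ⊛ g) n) ⟩
    f 0 * g 0 * h (suc n) + (((f 0 ∙ (g ∘ suc)) ⊛ h) n + (((f ∘ suc) ⊛ g) ⊛ h) n)
  ≡⟨ cong₂ (λ x y → f 0 * g 0 * h (suc n) + (x + y))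
           (∙-⊛ (f 0) (g ∘ suc) h n) (⊛-assoc (f ∘ suc) g h n) ⟩
    f 0 * g 0 * h (suc n) + (f 0 * ((g ∘ suc) ⊛ h) n + ((f ∘ suc) ⊛ (g ⊛ h)) n)
  ≡⟨ regroup (f 0) (g 0) (h (suc n)) _ _ ⟩
    f 0 * (g 0 * h (suc n) + ((g ∘ suc) ⊛ h) n) + ((f ∘ suc) ⊛ (g ⊛ h)) n ∎
  where
  open ≡.≡-Reasoning
  regroup : ∀ x y z u v → x * y * z + (x * u + v) ≡ x * (y * z + u) + v
  regroup = solve-∀

⊛-sucʳ : ∀ f g n → (f ⊛ g) (suc n) ≡ (f ⊛ (g ∘ suc)) n + f (suc n) * g 0
⊛-sucʳ f g zero    = refl
⊛-sucʳ f g (suc n) = trans (cong (_+_ (f 0 * g (suc (suc n)))) (⊛-sucʳ (f ∘ suc) g n))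
                           (sym (ℤ.+-assoc (f 0 * g (suc (suc n))) _ _))

⊛-comm : ∀ f g → f ⊛ g ≈ g ⊛ f
⊛-comm f g zero    = ℤ.*-comm (f 0) (g 0)
⊛-comm f g (suc n) = begin
    f 0 * g (suc n) + ((f ∘ suc) ⊛ g) n
  ≡⟨ cong₂ _+_ (ℤ.*-comm (f 0) (g (suc n))) (⊛-comm (f ∘ suc) g n) ⟩
    g (suc n) * f 0 + (g ⊛ (f ∘ suc)) n
  ≡⟨ ℤ.+-comm (g (suc n) * f 0) _ ⟩
    (g ⊛ (f ∘ suc)) n + g (suc n) * f 0
  ≡⟨ ⊛-sucʳ g f n ⟨
    (g ⊛ f) (suc n) ∎
  where open ≡.≡-Reasoning

⊛-zeroˡ : ∀ f → 𝟘 ⊛ f ≈ 𝟘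
⊛-zeroˡ f zero    = refl
⊛-zeroˡ f (suc n) = trans (ℤ.+-identityˡ _) (⊛-zeroˡ f n)

⊛-zeroʳ : ∀ f → f ⊛ 𝟘 ≈ 𝟘
⊛-zeroʳ f n = trans (⊛-comm f 𝟘 n) (⊛-zeroˡ f n)

⟪⟫-⊛ : ∀ c f n → (⟪ c ⟫ ⊛ f) n ≡ c * f n
⟪⟫-⊛ c f zero    = refl
⟪⟫-⊛ c f (suc n) = trans (cong (_+_ (c * f (suc n))) (⊛-zeroˡ f n)) (ℤ.+-identityʳ _)

⊛-identityˡ : ∀ f → 𝟙 ⊛ f ≈ f
⊛-identityˡ f n = trans (⟪⟫-⊛ 1ℤ f n) (ℤ.*-identityˡ (f n))

⊛-identityʳ : ∀ f → f ⊛ 𝟙 ≈ f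
⊛-identityʳ f n = trans (⊛-comm f 𝟙 n) (⊛-identityˡ f n)

series-isCommutativeRing : IsCommutativeRing _≈_ _⊕_ _⊛_ ⊖_ 𝟘 𝟙
series-isCommutativeRing = record
  { isRing = record
    { +-isAbelianGroup = record
      { isGroup = record
        { isMonoid = record
          { isSemigroup = record
            { isMagma = record
              { isEquivalence = ≈-isEquivalence
              ; ∙-cong        = λ f≈ g≈ n → cong₂ _+_ (f≈ n) (g≈ n)
              }
            ; assoc = λ f g h n → ℤ.+-assoc (f n) (g n) (h n)
            }
          ; identity = (λ f n → ℤ.+-identityˡ (f n)) , (λ f n → ℤ.+-identityʳ (f n))
          }
        ; inverse = (λ f n → ℤ.+-inverseˡ (f n)) , (λ f n → ℤ.+-inverseʳ (f n))
        ; ⁻¹-cong = λ f≈ n → cong -_ (f≈ n)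
        }
      ; comm = λ f g n → ℤ.+-comm (f n) (g n)
      }
    ; *-cong     = ⊛-cong
    ; *-assoc    = ⊛-assoc
    ; *-identity = ⊛-identityˡ , ⊛-identityʳ
    ; distrib    = (λ h f g n → trans (⊛-comm h (f ⊕ g) n)
                                  (trans (⊛-distribʳ h f g n) (cong₂ _+_ (⊛-comm f h n) (⊛-comm g h n))))
                 , ⊛-distribʳ
    }
  ; *-comm = ⊛-comm
  }

seriesRing : CommutativeRing 0ℓ 0ℓ
seriesRing = record { isCommutativeRing = series-isCommutativeRing }

open CommutativeRing seriesRing using (setoid; +-cong; +-congˡ; +-congʳ; *-congˡ; *-congʳ; -‿cong)

module ≈-Reasoning = SetoidReasoning setoid

ℤ-rawRing : RawRing 0ℓ 0ℓ
ℤ-rawRing = CommutativeRing.rawRing ℤ.+-*-commutativeRing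

seriesACR : AlmostCommutativeRing 0ℓ 0ℓ
seriesACR = fromCommutativeRing seriesRing

⟪⟫-* : ∀ a b → ⟪ a * b ⟫ ≈ ⟪ a ⟫ ⊛ ⟪ b ⟫
⟪⟫-* a b zero    = refl
⟪⟫-* a b (suc n) = sym (trans (⟪⟫-⊛ a ⟪ b ⟫ (suc n)) (ℤ.*-zeroʳ a))

⟪⟫-homomorphism : ℤ-rawRing -Raw-AlmostCommutative⟶ seriesACR
⟪⟫-homomorphism = record
  { ⟦_⟧    = ⟪_⟫
  ; +-homo = λ { a b zero → refl ; a b (suc n) → refl }
  ; *-homo = ⟪⟫-*
  ; -‿homo = λ { a zero → refl ; a (suc n) → refl }
  ; 0-homo = λ { zero → refl ; (suc n) → refl }
  ; 1-homo = λ _ → refl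
  }

⟪⟫-≟ : ∀ a b → Maybe (⟪ a ⟫ ≈ ⟪ b ⟫)
⟪⟫-≟ a b with a ℤ.≟ b
... | yes refl = just ≈-refl
... | no _     = nothing

open import Algebra.Solver.Ring ℤ-rawRing seriesACR ⟪⟫-homomorphism ⟪⟫-≟
  using (solve; _:=_; _:+_; _:-_; _:*_; :-_; con)

sum≤ : (ℕ → ℤ) → ℕ → ℤ
sum≤ h zero    = h 0
sum≤ h (suc n) = sum≤ h n + h (suc n)

sum≤-cong : ∀ f g n → (∀ k → k ≤ n → f k ≡ g k) → sum≤ f n ≡ sum≤ g n
sum≤-cong f g zero    f≡g = f≡g 0 z≤n
sum≤-cong f g (suc n) f≡g =
  cong₂ _+_ (sum≤-cong f g n (λ k k≤n → f≡g k (ℕ.m≤n⇒m≤1+n k≤n))) (f≡g (suc n) ℕ.≤-refl)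

sum≤-+ : ∀ f g n → sum≤ (λ k → f k + g k) n ≡ sum≤ f n + sum≤ g n
sum≤-+ f g zero    = refl
sum≤-+ f g (suc n) = trans (cong (_+ (f (suc n) + g (suc n))) (sum≤-+ f g n))
                           (interchange (sum≤ f n) (sum≤ g n) (f (suc n)) (g (suc n)))
  where
  interchange : ∀ a b c d → a + b + (c + d) ≡ a + c + (b + d)
  interchange = solve-∀

sum≤-*ˡ : ∀ c f n → sum≤ (λ k → c * f k) n ≡ c * sum≤ f n
sum≤-*ˡ c f zero    = refl
sum≤-*ˡ c f (suc n) = trans (cong (_+ c * f (suc n)) (sum≤-*ˡ c f n)) (sym (ℤ.*-distribˡ-+ c _ _))

sum≤-extend : ∀ h m d → (∀ k → m < k → h k ≡ 0ℤ) → sum≤ h (m ℕ.+ d) ≡ sum≤ h m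
sum≤-extend h m zero    h≡0 = cong (sum≤ h) (ℕ.+-identityʳ m)
sum≤-extend h m (suc d) h≡0 = begin
    sum≤ h (m ℕ.+ suc d)               ≡⟨ cong (sum≤ h) (ℕ.+-suc m d) ⟩
    sum≤ h (m ℕ.+ d) + h (suc m ℕ.+ d) ≡⟨ cong (_+_ (sum≤ h (m ℕ.+ d))) (h≡0 _ (s≤s (ℕ.m≤m+n m d))) ⟩
    sum≤ h (m ℕ.+ d) + 0ℤ              ≡⟨ ℤ.+-identityʳ _ ⟩
    sum≤ h (m ℕ.+ d)                   ≡⟨ sum≤-extend h m d h≡0 ⟩
    sum≤ h m                           ∎
  where open ≡.≡-Reasoning

⊛-sum≤ : ∀ f g n → (f ⊛ g) n ≡ sum≤ (λ k → f k * g (n ∸ k)) n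
⊛-sum≤ f g zero    = refl
⊛-sum≤ f g (suc n) = trans (⊛-sucʳ f g n) (cong₂ _+_
  (trans (⊛-sum≤ f (g ∘ suc) n)
         (sum≤-cong _ _ n (λ k k≤n → cong (λ x → f k * g x) (sym (ℕ.+-∸-assoc 1 k≤n)))))
  (cong (λ x → f (suc n) * g x) (sym (ℕ.n∸n≡0 n))))

shift : Series → Series
shift f zero    = 0ℤ
shift f (suc n) = f n

shift-cong : ∀ {f g} → f ≈ g → shift f ≈ shift g
shift-cong f≈g zero    = refl
shift-cong f≈g (suc n) = f≈g n

shift-⊛ : ∀ f g → shift f ⊛ g ≈ shift (f ⊛ g)
shift-⊛ f g zero    = refl
shift-⊛ f g (suc n) = ℤ.+-identityˡ _

infix 9 q^_
q^_ : ℕ → Series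
q^ zero    = 𝟙
q^ (suc k) = shift (q^ k)

q^-cong : ∀ {a b} → a ≡ b → q^ a ≈ q^ b
q^-cong refl = ≈-refl

q^-+ : ∀ a b → q^ (a ℕ.+ b) ≈ q^ a ⊛ q^ b
q^-+ zero    b = ≈-sym (⊛-identityˡ (q^ b))
q^-+ (suc a) b = ≈-trans (shift-cong (q^-+ a b)) (≈-sym (shift-⊛ (q^ a) (q^ b)))

q^-diagonal : ∀ k → (q^ k) k ≡ 1ℤ
q^-diagonal zero    = refl
q^-diagonal (suc k) = q^-diagonal k

q^-offDiagonal : ∀ k m → m ≢ k → (q^ k) m ≡ 0ℤ
q^-offDiagonal zero    zero    m≢k = ⊥-elim (m≢k refl)
q^-offDiagonal zero    (suc m) m≢k = refl
q^-offDiagonal (suc k) zero    m≢k = refl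
q^-offDiagonal (suc k) (suc m) m≢k = q^-offDiagonal k m (m≢k ∘ cong suc)

∙-q^-offDiagonal : ∀ c k m → m ≢ k → (c ∙ q^ k) m ≡ 0ℤ
∙-q^-offDiagonal c k m m≢k = trans (cong (c *_) (q^-offDiagonal k m m≢k)) (ℤ.*-zeroʳ c)

q^-⊛-below : ∀ s f m → m < s → (q^ s ⊛ f) m ≡ 0ℤ
q^-⊛-below (suc s) f zero    _         = shift-⊛ (q^ s) f 0
q^-⊛-below (suc s) f (suc m) (s≤s m<s) = trans (shift-⊛ (q^ s) f (suc m)) (q^-⊛-below s f m m<s)

q^-⊛-+ : ∀ s f m → (q^ s ⊛ f) (s ℕ.+ m) ≡ f m
q^-⊛-+ zero    f m = ⊛-identityˡ f m
q^-⊛-+ (suc s) f m = trans (shift-⊛ (q^ s) f (suc (s ℕ.+ m))) (q^-⊛-+ s f m)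

infix 4 _≈[_]_
_≈[_]_ : Series → ℕ → Series → Set
f ≈[ L ] g = ∀ m → m < L → f m ≡ g m

≈⇒≈[] : ∀ {f g L} → f ≈ g → f ≈[ L ] g
≈⇒≈[] f≈g m _ = f≈g m

≈[]-refl : ∀ {f L} → f ≈[ L ] f
≈[]-refl _ _ = refl

≈[]-sym : ∀ {f g L} → f ≈[ L ] g → g ≈[ L ] f
≈[]-sym f≈g m m<L = sym (f≈g m m<L)

≈[]-trans : ∀ {f g h L} → f ≈[ L ] g → g ≈[ L ] h → f ≈[ L ] h
≈[]-trans f≈g g≈h m m<L = trans (f≈g m m<L) (g≈h m m<L)

≈[]-weaken : ∀ {f g L L′} → L′ ≤ L → f ≈[ L ] g → f ≈[ L′ ] g
≈[]-weaken L′≤L f≈g m m<L′ = f≈g m (ℕ.<-≤-trans m<L′ L′≤L)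

⊕-cong[] : ∀ {f f′ g g′ L} → f ≈[ L ] f′ → g ≈[ L ] g′ → f ⊕ g ≈[ L ] f′ ⊕ g′
⊕-cong[] f≈ g≈ m m<L = cong₂ _+_ (f≈ m m<L) (g≈ m m<L)

⊛-cong-upTo : ∀ m {f f′ g g′} → (∀ i → i ≤ m → f i ≡ f′ i) → (∀ i → i ≤ m → g i ≡ g′ i) →
              (f ⊛ g) m ≡ (f′ ⊛ g′) m
⊛-cong-upTo zero    f≈ g≈ = cong₂ _*_ (f≈ 0 z≤n) (g≈ 0 z≤n)
⊛-cong-upTo (suc m) f≈ g≈ =
  cong₂ _+_ (cong₂ _*_ (f≈ 0 z≤n) (g≈ (suc m) ℕ.≤-refl))
            (⊛-cong-upTo m (λ i i≤m → f≈ (suc i) (s≤s i≤m))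
                           (λ i i≤m → g≈ i (ℕ.m≤n⇒m≤1+n i≤m)))

⊛-cong[] : ∀ {f f′ g g′ L} → f ≈[ L ] f′ → g ≈[ L ] g′ → f ⊛ g ≈[ L ] f′ ⊛ g′
⊛-cong[] f≈ g≈ m m<L =
  ⊛-cong-upTo m (λ i i≤m → f≈ i (ℕ.≤-<-trans i≤m m<L)) (λ i i≤m → g≈ i (ℕ.≤-<-trans i≤m m<L))

q^-⊛-cong[] : ∀ s {f g L} → f ≈[ L ] g → q^ s ⊛ f ≈[ s ℕ.+ L ] q^ s ⊛ g
q^-⊛-cong[] zero    {f} {g} f≈g m m<L =
  trans (⊛-identityˡ f m) (trans (f≈g m m<L) (sym (⊛-identityˡ g m)))
q^-⊛-cong[] (suc s) {f} {g} f≈g zero _ =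
  trans (shift-⊛ (q^ s) f 0) (sym (shift-⊛ (q^ s) g 0))
q^-⊛-cong[] (suc s) {f} {g} f≈g (suc m) (s≤s m<s+L) =
  trans (shift-⊛ (q^ s) f (suc m)) (trans (q^-⊛-cong[] s f≈g m m<s+L) (sym (shift-⊛ (q^ s) g (suc m))))

⊛≈𝟘⇒≈𝟘 : ∀ p x → p 0 ≡ 1ℤ → p ⊛ x ≈ 𝟘 → x ≈ 𝟘
⊛≈𝟘⇒≈𝟘 p x p₀≡1 px≈0 m = vanishes-upTo m m ℕ.≤-refl
  where
  leading : ∀ m → ((p ∘ suc) ⊛ x) m ≡ 0ℤ → x (suc m) ≡ 0ℤ
  leading m rest≡0 = begin
      x (suc m)                           ≡⟨ ℤ.*-identityˡ (x (suc m)) ⟨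
      1ℤ * x (suc m)                      ≡⟨ cong (_* x (suc m)) p₀≡1 ⟨
      p 0 * x (suc m)                     ≡⟨ ℤ.+-identityʳ _ ⟨
      p 0 * x (suc m) + 0ℤ                ≡⟨ cong (_+_ (p 0 * x (suc m))) rest≡0 ⟨
      p 0 * x (suc m) + ((p ∘ suc) ⊛ x) m ≡⟨ px≈0 (suc m) ⟩
      0ℤ                                  ∎
    where open ≡.≡-Reasoning
  vanishes-upTo : ∀ m i → i ≤ m → x i ≡ 0ℤ
  vanishes-upTo zero    zero z≤n = trans (sym (ℤ.*-identityˡ (x 0))) (trans (cong (_* x 0) (sym p₀≡1)) (px≈0 0))
  vanishes-upTo (suc m) i i≤1+m with ℕ.m≤n⇒m<n∨m≡n i≤1+m
  ... | inj₁ (s≤s i≤m) = vanishes-upTo m i i≤m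
  ... | inj₂ refl      =
    leading m (trans (⊛-cong-upTo m (λ _ _ → refl) (vanishes-upTo m)) (⊛-zeroʳ (p ∘ suc) m))

⊛-cancelʳ : ∀ p x y → p 0 ≡ 1ℤ → x ⊛ p ≈ y ⊛ p → x ≈ y
⊛-cancelʳ p x y p₀≡1 xp≈yp n =
  ℤ.i-j≡0⇒i≡j (x n) (y n) (⊛≈𝟘⇒≈𝟘 p (x ⊕ ⊖ y) p₀≡1 p[x-y]≈0 n)
  where
  p[x-y]≈0 : p ⊛ (x ⊕ ⊖ y) ≈ 𝟘
  p[x-y]≈0 = begin
      p ⊛ (x ⊕ ⊖ y)      ≈⟨ solve 3 (λ p x y → p :* (x :- y) := x :* p :- y :* p) ≈-refl p x y ⟩
      x ⊛ p ⊕ ⊖ (y ⊛ p)  ≈⟨ +-congʳ xp≈yp ⟩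
      y ⊛ p ⊕ ⊖ (y ⊛ p)  ≈⟨ (λ n → ℤ.+-inverseʳ ((y ⊛ p) n)) ⟩
      𝟘                  ∎
    where open ≈-Reasoning

θ : Series → Series
θ f m = + m * f m

θ-⊛ : ∀ f g → θ (f ⊛ g) ≈ θ f ⊛ g ⊕ f ⊛ θ g
θ-⊛ f g n = begin
    + n * (f ⊛ g) n
  ≡⟨ cong (+ n *_) (⊛-sum≤ f g n) ⟩
    + n * sum≤ (λ k → f k * g (n ∸ k)) n
  ≡⟨ sum≤-*ˡ (+ n) _ n ⟨
    sum≤ (λ k → + n * (f k * g (n ∸ k))) n
  ≡⟨ sum≤-cong _ _ n split ⟩
    sum≤ (λ k → θ f k * g (n ∸ k) + f k * θ g (n ∸ k)) n
  ≡⟨ sum≤-+ _ _ n ⟩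
    sum≤ (λ k → θ f k * g (n ∸ k)) n + sum≤ (λ k → f k * θ g (n ∸ k)) n
  ≡⟨ cong₂ _+_ (⊛-sum≤ (θ f) g n) (⊛-sum≤ f (θ g) n) ⟨
    (θ f ⊛ g) n + (f ⊛ θ g) n ∎
  where
  open ≡.≡-Reasoning
  leibniz : ∀ a b x y → (a + b) * (x * y) ≡ a * x * y + x * (b * y)
  leibniz = solve-∀
  split : ∀ k → k ≤ n → + n * (f k * g (n ∸ k)) ≡ θ f k * g (n ∸ k) + f k * θ g (n ∸ k)
  split k k≤n = trans (cong (_* (f k * g (n ∸ k))) n≡k+[n∸k]) (leibniz (+ k) (+ (n ∸ k)) (f k) (g (n ∸ k)))
    where
    n≡k+[n∸k] : + n ≡ + k + + (n ∸ k)
    n≡k+[n∸k] = trans (cong +_ (sym (ℕ.m+[n∸m]≡n k≤n))) (ℤ.pos-+ k (n ∸ k))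

θ-q^ : ∀ k → θ (q^ k) ≈ (+ k) ∙ q^ k
θ-q^ k m with m ℕ.≟ k
... | yes refl = refl
... | no  m≢k  = trans (∙-q^-offDiagonal (+ m) k m m≢k) (sym (∙-q^-offDiagonal (+ k) k m m≢k))

-- Euler products and their logarithmic derivatives

infix 9 1-q^_
1-q^_ : ℕ → Series
1-q^ k = 𝟙 ⊕ ⊖ q^ k

1-q^-≈[] : ∀ {L k} → L ≤ k → 1-q^ k ≈[ L ] 𝟙
1-q^-≈[] {L} {k} L≤k m m<L =
  trans (cong (λ x → 𝟙 m + - x) (q^-offDiagonal k m (ℕ.<⇒≢ (ℕ.<-≤-trans m<L L≤k))))
        (ℤ.+-identityʳ (𝟙 m))

θ-1-q^ : ∀ k → θ (1-q^ k) ≈ ⊖ ((+ k) ∙ q^ k)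
θ-1-q^ k = begin
    θ (𝟙 ⊕ ⊖ q^ k)        ≈⟨ (λ m → ℤ.*-distribˡ-+ (+ m) (𝟙 m) _) ⟩
    θ 𝟙 ⊕ θ (⊖ q^ k)      ≈⟨ +-cong θ𝟙≈𝟘 (λ m → sym (ℤ.neg-distribʳ-* (+ m) ((q^ k) m))) ⟩
    𝟘 ⊕ ⊖ θ (q^ k)        ≈⟨ (λ m → ℤ.+-identityˡ _) ⟩
    ⊖ θ (q^ k)            ≈⟨ -‿cong (θ-q^ k) ⟩
    ⊖ ((+ k) ∙ q^ k)      ∎
  where
  open ≈-Reasoning
  θ𝟙≈𝟘 : θ 𝟙 ≈ 𝟘
  θ𝟙≈𝟘 zero    = refl
  θ𝟙≈𝟘 (suc m) = ℤ.*-zeroʳ (+ suc m)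

euler : ℕ → Series
euler zero    = 𝟙
euler (suc n) = euler n ⊛ 1-q^ (suc n)

multiples : ℕ → Series
multiples k zero = 0ℤ
multiples k (suc m) with k ℕ.∣? suc m
... | yes _ = + k
... | no  _ = 0ℤ

multiples-below : ∀ k m → m < suc k → multiples (suc k) m ≡ 0ℤ
multiples-below k zero    _   = refl
multiples-below k (suc m) m<k with suc k ℕ.∣? suc m
... | yes k∣m = contradiction (ℕ.∣⇒≤ k∣m) (ℕ.<⇒≱ m<k)
... | no  _   = refl

multiples-step : ∀ k r →
  multiples (suc k) (suc k ℕ.+ r) + - multiples (suc k) r ≡ ((+ suc k) ∙ q^ (suc k)) (suc k ℕ.+ r)
multiples-step k zero rewrite ℕ.+-identityʳ k with suc k ℕ.∣? suc k
... | yes _    = trans (ℤ.+-identityʳ (+ suc k))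
                       (sym (trans (cong (+ suc k *_) (q^-diagonal (suc k))) (ℤ.*-identityʳ (+ suc k))))
... | no ¬k∣k = contradiction ℕ.∣-refl ¬k∣k
multiples-step k (suc r) with suc k ℕ.∣? suc (k ℕ.+ suc r) | suc k ℕ.∣? suc r
... | yes _   | yes _   =
  trans (ℤ.+-inverseʳ (+ suc k)) (sym (∙-q^-offDiagonal (+ suc k) (suc k) _ (ℕ.m+1+n≢m (suc k))))
... | no _    | no _    = sym (∙-q^-offDiagonal (+ suc k) (suc k) _ (ℕ.m+1+n≢m (suc k)))
... | yes k∣  | no ¬k∣  = contradiction (ℕ.∣m+n∣m⇒∣n k∣ ℕ.∣-refl) ¬k∣
... | no ¬k∣  | yes k∣  = contradiction (ℕ.∣m∣n⇒∣m+n ℕ.∣-refl k∣) ¬k∣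

multiples-⊛-1-q^ : ∀ k → multiples (suc k) ⊛ 1-q^ (suc k) ≈ (+ suc k) ∙ q^ (suc k)
multiples-⊛-1-q^ k = ≈-trans expand coefficients
  where
  K = suc k
  G = multiples K
  expand : G ⊛ 1-q^ K ≈ G ⊕ ⊖ (q^ K ⊛ G)
  expand = solve 2 (λ g x → g :* (con 1ℤ :- x) := g :- x :* g) ≈-refl G (q^ K)
  coefficients : G ⊕ ⊖ (q^ K ⊛ G) ≈ (+ K) ∙ q^ K
  coefficients m with m ℕ.<? K
  ... | yes m<K = trans (cong₂ (λ a b → a + - b) (multiples-below k m m<K) (q^-⊛-below K G m m<K))
                        (sym (∙-q^-offDiagonal (+ K) K m (ℕ.<⇒≢ m<K)))
  ... | no  m≮K = ≡.subst (λ x → G x + - (q^ K ⊛ G) x ≡ + K * (q^ K) x) (ℕ.m+[n∸m]≡n (ℕ.≮⇒≥ m≮K))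
                    (trans (cong (λ w → G (K ℕ.+ (m ∸ K)) + - w) (q^-⊛-+ K G (m ∸ K)))
                           (multiples-step k (m ∸ K)))

σ≤ : ℕ → Series
σ≤ zero    = 𝟘
σ≤ (suc M) = σ≤ M ⊕ multiples (suc M)

θ-euler : ∀ M → θ (euler M) ≈ ⊖ (σ≤ M ⊛ euler M)
θ-euler zero zero    = refl
θ-euler zero (suc m) = trans (ℤ.*-zeroʳ (+ suc m)) (sym (cong -_ (⊛-zeroˡ 𝟙 (suc m))))
θ-euler (suc M) = begin
    θ (euler M ⊛ 1-q^ K)
  ≈⟨ θ-⊛ (euler M) (1-q^ K) ⟩
    θ (euler M) ⊛ 1-q^ K ⊕ euler M ⊛ θ (1-q^ K)
  ≈⟨ +-cong (*-congʳ (θ-euler M))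
            (*-congˡ (≈-trans (θ-1-q^ K) (-‿cong (≈-sym (multiples-⊛-1-q^ M))))) ⟩
    ⊖ (σ≤ M ⊛ euler M) ⊛ 1-q^ K ⊕ euler M ⊛ ⊖ (multiples K ⊛ 1-q^ K)
  ≈⟨ solve 4 (λ a p e g → (:- (a :* p)) :* e :+ p :* (:- (g :* e)) := :- ((a :+ g) :* (p :* e)))
       ≈-refl (σ≤ M) (euler M) (1-q^ K) (multiples K) ⟩
    ⊖ ((σ≤ M ⊕ multiples K) ⊛ (euler M ⊛ 1-q^ K)) ∎
  where
  K = suc M
  open ≈-Reasoning

divisorSum≤ : ℕ → ℕ → ℕ
divisorSum≤ K m = sum (filter (ℕ._∣? m) (map suc (upTo K)))

divisorSum≤-suc : ∀ K m → divisorSum≤ (suc K) m ≡ divisorSum≤ K m ℕ.+ sum (filter (ℕ._∣? m) [ suc K ])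
divisorSum≤-suc K m = begin
    sum (filter (ℕ._∣? m) (map suc (upTo (suc K))))
  ≡⟨ cong (λ xs → sum (filter (ℕ._∣? m) (map suc xs))) (List.upTo-∷ʳ K) ⟨
    sum (filter (ℕ._∣? m) (map suc (upTo K ++ [ K ])))
  ≡⟨ cong (λ xs → sum (filter (ℕ._∣? m) xs)) (List.map-++ suc (upTo K) [ K ]) ⟩
    sum (filter (ℕ._∣? m) (map suc (upTo K) ++ [ suc K ]))
  ≡⟨ cong sum (List.filter-++ (ℕ._∣? m) (map suc (upTo K)) [ suc K ]) ⟩
    sum (filter (ℕ._∣? m) (map suc (upTo K)) ++ filter (ℕ._∣? m) [ suc K ])
  ≡⟨ ℕ.sum-++ (filter (ℕ._∣? m) (map suc (upTo K))) (filter (ℕ._∣? m) [ suc K ]) ⟩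
    divisorSum≤ K m ℕ.+ sum (filter (ℕ._∣? m) [ suc K ]) ∎
  where open ≡.≡-Reasoning

σ≤-divisorSum≤ : ∀ M m → σ≤ M (suc m) ≡ + divisorSum≤ M (suc m)
σ≤-divisorSum≤ zero    m = refl
σ≤-divisorSum≤ (suc M) m =
  trans (cong (_+ multiples (suc M) (suc m)) (σ≤-divisorSum≤ M m))
        (trans (last-divisor (divisorSum≤ M (suc m))) (cong +_ (sym (divisorSum≤-suc M (suc m)))))
  where
  last-divisor : ∀ a → + a + multiples (suc M) (suc m) ≡ + (a ℕ.+ sum (filter (ℕ._∣? suc m) [ suc M ]))
  last-divisor a with suc M ℕ.∣? suc m
  ... | yes d = cong (λ w → + (a ℕ.+ w)) (sym (trans (cong sum (List.filter-accept (ℕ._∣? suc m) {xs = []} d))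
                                                     (ℕ.+-identityʳ (suc M))))
  ... | no ¬d = cong (λ xs → + (a ℕ.+ sum xs)) (sym (List.filter-reject (ℕ._∣? suc m) {xs = []} ¬d))

divisorSum≤-stable : ∀ K m → suc m ≤ K → divisorSum≤ K (suc m) ≡ σ (suc m)
divisorSum≤-stable (suc K) m m<1+K with ℕ.m≤n⇒m<n∨m≡n m<1+K
... | inj₂ refl      = refl
... | inj₁ (s≤s m<K) =
  trans (divisorSum≤-suc K (suc m))
        (trans (cong₂ ℕ._+_ (divisorSum≤-stable K m m<K) too-big) (ℕ.+-identityʳ _))
  where
  too-big : sum (filter (ℕ._∣? suc m) [ suc K ]) ≡ 0
  too-big with suc K ℕ.∣? suc m
  ... | yes d = contradiction (ℕ.∣⇒≤ d) (ℕ.<⇒≱ (s≤s m<K))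
  ... | no ¬d = cong sum (List.filter-reject (ℕ._∣? suc m) {xs = []} ¬d)

σ≤-zero : ∀ M → σ≤ M 0 ≡ 0ℤ
σ≤-zero zero    = refl
σ≤-zero (suc M) = trans (ℤ.+-identityʳ (σ≤ M 0)) (σ≤-zero M)

σ-series : Series
σ-series m = + σ m

σ≤-≈[] : ∀ M → σ≤ M ≈[ suc M ] σ-series
σ≤-≈[] M zero    _         = σ≤-zero M
σ≤-≈[] M (suc m) (s≤s m<M) = trans (σ≤-divisorSum≤ M m) (cong +_ (divisorSum≤-stable M m m<M))

-- Gaussian binomial coefficients

gauss : ℕ → ℕ → Series
gauss zero    zero    = 𝟙
gauss zero    (suc j) = 𝟘
gauss (suc N) zero    = 𝟙
gauss (suc N) (suc j) = gauss N j ⊕ q^ (suc j) ⊛ gauss N (suc j)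

eulerTop : ℕ → ℕ → Series
eulerTop N zero    = 𝟙
eulerTop N (suc j) = 1-q^ (N ∸ j) ⊛ eulerTop N j

eulerTop-suc : ∀ N j → eulerTop (suc N) (suc j) ≈ 1-q^ (suc N) ⊛ eulerTop N j
eulerTop-suc N zero    = ≈-refl
eulerTop-suc N (suc j) = begin
    1-q^ (N ∸ j) ⊛ eulerTop (suc N) (suc j)
  ≈⟨ *-congˡ (eulerTop-suc N j) ⟩
    1-q^ (N ∸ j) ⊛ (1-q^ (suc N) ⊛ eulerTop N j)
  ≈⟨ solve 3 (λ a b c → a :* (b :* c) := b :* (a :* c)) ≈-refl (1-q^ (N ∸ j)) (1-q^ (suc N)) (eulerTop N j) ⟩
    1-q^ (suc N) ⊛ (1-q^ (N ∸ j) ⊛ eulerTop N j) ∎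
  where open ≈-Reasoning

eulerTop-vanishes : ∀ N j → N < j → eulerTop N j ≈ 𝟘
eulerTop-vanishes N (suc j) (s≤s N≤j) with ℕ.m≤n⇒m<n∨m≡n N≤j
... | inj₁ N<j  = ≈-trans (*-congˡ (eulerTop-vanishes N j N<j)) (⊛-zeroʳ _)
... | inj₂ refl = ≈-trans (*-congʳ 1-q^0≈𝟘) (⊛-zeroˡ (eulerTop N N))
  where
  1-q^0≈𝟘 : 1-q^ (N ∸ N) ≈ 𝟘
  1-q^0≈𝟘 n = trans (cong (λ k → (1-q^ k) n) (ℕ.n∸n≡0 N)) (ℤ.+-inverseʳ (𝟙 n))

gauss-vanishes : ∀ N j → N < j → gauss N j ≈ 𝟘
gauss-vanishes zero    (suc j) _         = ≈-refl
gauss-vanishes (suc N) (suc j) (s≤s N<j) = begin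
    gauss N j ⊕ q^ (suc j) ⊛ gauss N (suc j)
  ≈⟨ +-cong (gauss-vanishes N j N<j) (*-congˡ (gauss-vanishes N (suc j) (ℕ.m<n⇒m<1+n N<j))) ⟩
    𝟘 ⊕ q^ (suc j) ⊛ 𝟘
  ≈⟨ (λ n → trans (ℤ.+-identityˡ _) (⊛-zeroʳ (q^ (suc j)) n)) ⟩
    𝟘 ∎
  where open ≈-Reasoning

euler-constantTerm : ∀ j → euler j 0 ≡ 1ℤ
euler-constantTerm zero    = refl
euler-constantTerm (suc j) = trans (ℤ.*-identityʳ (euler j 0)) (euler-constantTerm j)

gauss-⊛-euler : ∀ N j → gauss N j ⊛ euler j ≈ eulerTop N j
gauss-⊛-euler zero    zero    = ⊛-identityˡ 𝟙
gauss-⊛-euler zero    (suc j) = ≈-trans (⊛-zeroˡ _) (≈-sym (eulerTop-vanishes 0 (suc j) (s≤s z≤n)))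
gauss-⊛-euler (suc N) zero    = ⊛-identityˡ 𝟙
gauss-⊛-euler (suc N) (suc j) = begin
    (gauss N j ⊕ q^ (suc j) ⊛ gauss N (suc j)) ⊛ (euler j ⊛ 1-q^ (suc j))
  ≈⟨ solve 5 (λ b b′ m p e → (b :+ m :* b′) :* (p :* e) := (b :* p) :* e :+ m :* (b′ :* (p :* e)))
       ≈-refl (gauss N j) (gauss N (suc j)) (q^ (suc j)) (euler j) (1-q^ (suc j)) ⟩
    (gauss N j ⊛ euler j) ⊛ 1-q^ (suc j) ⊕ q^ (suc j) ⊛ (gauss N (suc j) ⊛ euler (suc j))
  ≈⟨ +-cong (*-congʳ (gauss-⊛-euler N j)) (*-congˡ (gauss-⊛-euler N (suc j))) ⟩
    eulerTop N j ⊛ 1-q^ (suc j) ⊕ q^ (suc j) ⊛ (1-q^ (N ∸ j) ⊛ eulerTop N j)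
  ≈⟨ collect ⟩
    1-q^ (suc N) ⊛ eulerTop N j
  ≈⟨ eulerTop-suc N j ⟨
    eulerTop (suc N) (suc j) ∎
  where
  open ≈-Reasoning
  collect : eulerTop N j ⊛ 1-q^ (suc j) ⊕ q^ (suc j) ⊛ (1-q^ (N ∸ j) ⊛ eulerTop N j)
          ≈ 1-q^ (suc N) ⊛ eulerTop N j
  collect with j ℕ.≤? N
  ... | yes j≤N = begin
      eulerTop N j ⊛ 1-q^ (suc j) ⊕ q^ (suc j) ⊛ (1-q^ (N ∸ j) ⊛ eulerTop N j)
    ≈⟨ solve 3 (λ t a b → t :* (con 1ℤ :- a) :+ a :* ((con 1ℤ :- b) :* t) := (con 1ℤ :- a :* b) :* t)
         ≈-refl (eulerTop N j) (q^ (suc j)) (q^ (N ∸ j)) ⟩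
      (𝟙 ⊕ ⊖ (q^ (suc j) ⊛ q^ (N ∸ j))) ⊛ eulerTop N j
    ≈⟨ *-congʳ (+-congˡ {x = 𝟙} (-‿cong (≈-sym q^[1+N]))) ⟩
      1-q^ (suc N) ⊛ eulerTop N j ∎
    where
    q^[1+N] : q^ (suc N) ≈ q^ (suc j) ⊛ q^ (N ∸ j)
    q^[1+N] = ≈-trans (q^-cong (cong suc (sym (ℕ.m+[n∸m]≡n j≤N)))) (q^-+ (suc j) (N ∸ j))
  ... | no j≰N = begin
      eulerTop N j ⊛ 1-q^ (suc j) ⊕ q^ (suc j) ⊛ (1-q^ (N ∸ j) ⊛ eulerTop N j)
    ≈⟨ +-cong (*-congʳ top≈𝟘) (*-congˡ (*-congˡ top≈𝟘)) ⟩
      𝟘 ⊛ 1-q^ (suc j) ⊕ q^ (suc j) ⊛ (1-q^ (N ∸ j) ⊛ 𝟘)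
    ≈⟨ +-cong (⊛-zeroˡ (1-q^ (suc j)))
              (≈-trans (*-congˡ (⊛-zeroʳ (1-q^ (N ∸ j)))) (⊛-zeroʳ (q^ (suc j)))) ⟩
      𝟘 ⊕ 𝟘
    ≈⟨ ⊛-zeroʳ (1-q^ (suc N)) ⟨
      1-q^ (suc N) ⊛ 𝟘
    ≈⟨ *-congˡ (≈-sym top≈𝟘) ⟩
      1-q^ (suc N) ⊛ eulerTop N j ∎
    where
    top≈𝟘 = eulerTop-vanishes N j (ℕ.≰⇒> j≰N)

gauss-ratio : ∀ N j → 1-q^ (N ∸ j) ⊛ gauss N j ≈ 1-q^ (suc j) ⊛ gauss N (suc j)
gauss-ratio N j = ⊛-cancelʳ (euler j) _ _ (euler-constantTerm j) (begin
    (1-q^ (N ∸ j) ⊛ gauss N j) ⊛ euler j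
  ≈⟨ ⊛-assoc (1-q^ (N ∸ j)) (gauss N j) (euler j) ⟩
    1-q^ (N ∸ j) ⊛ (gauss N j ⊛ euler j)
  ≈⟨ *-congˡ (gauss-⊛-euler N j) ⟩
    eulerTop N (suc j)
  ≈⟨ gauss-⊛-euler N (suc j) ⟨
    gauss N (suc j) ⊛ (euler j ⊛ 1-q^ (suc j))
  ≈⟨ solve 3 (λ b p e → b :* (p :* e) := (e :* b) :* p) ≈-refl (gauss N (suc j)) (euler j) (1-q^ (suc j)) ⟩
    (1-q^ (suc j) ⊛ gauss N (suc j)) ⊛ euler j ∎)
  where open ≈-Reasoning

gauss-pascal′ : ∀ N j → gauss (suc N) (suc j) ≈ q^ (N ∸ j) ⊛ gauss N j ⊕ gauss N (suc j)
gauss-pascal′ N j = begin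
    gauss N j ⊕ q^ (suc j) ⊛ gauss N (suc j)
  ≈⟨ solve 4 (λ b b′ a m → b :+ m :* b′ := a :* b :+ (con 1ℤ :- a) :* b :+ m :* b′)
       ≈-refl (gauss N j) (gauss N (suc j)) (q^ (N ∸ j)) (q^ (suc j)) ⟩
    q^ (N ∸ j) ⊛ gauss N j ⊕ 1-q^ (N ∸ j) ⊛ gauss N j ⊕ q^ (suc j) ⊛ gauss N (suc j)
  ≈⟨ +-congʳ (+-congˡ {x = q^ (N ∸ j) ⊛ gauss N j} (gauss-ratio N j)) ⟩
    q^ (N ∸ j) ⊛ gauss N j ⊕ 1-q^ (suc j) ⊛ gauss N (suc j) ⊕ q^ (suc j) ⊛ gauss N (suc j)
  ≈⟨ solve 4 (λ b b′ a m → a :* b :+ (con 1ℤ :- m) :* b′ :+ m :* b′ := a :* b :+ b′)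
       ≈-refl (gauss N j) (gauss N (suc j)) (q^ (N ∸ j)) (q^ (suc j)) ⟩
    q^ (N ∸ j) ⊛ gauss N j ⊕ gauss N (suc j) ∎
  where open ≈-Reasoning

gauss-middle-symmetric : ∀ n → gauss (suc (n ℕ.+ n)) (suc n) ≈ gauss (suc (n ℕ.+ n)) n
gauss-middle-symmetric n = ⊛-cancelʳ (1-q^ (suc n)) _ _ refl (begin
    gauss N (suc n) ⊛ 1-q^ (suc n) ≈⟨ ⊛-comm (gauss N (suc n)) (1-q^ (suc n)) ⟩
    1-q^ (suc n) ⊛ gauss N (suc n) ≈⟨ gauss-ratio N n ⟨
    1-q^ (N ∸ n) ⊛ gauss N n       ≈⟨ *-congʳ (λ m → cong (λ k → (1-q^ k) m) (ℕ.m+n∸n≡m (suc n) n)) ⟩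
    1-q^ (suc n) ⊛ gauss N n       ≈⟨ ⊛-comm (1-q^ (suc n)) (gauss N n) ⟩
    gauss N n ⊛ 1-q^ (suc n)       ∎)
  where
  N = suc (n ℕ.+ n)
  open ≈-Reasoning

-- A finite form of Jacobi's identity

sumₛ : (ℕ → Series) → ℕ → Series
sumₛ f zero    = f 0
sumₛ f (suc L) = sumₛ f L ⊕ f (suc L)

sumₛ-pointwise : ∀ f L m → sumₛ f L m ≡ sum≤ (λ k → f k m) L
sumₛ-pointwise f zero    m = refl
sumₛ-pointwise f (suc L) m = cong (_+ f (suc L) m) (sumₛ-pointwise f L m)

sumₛ-⊛ : ∀ f p L → sumₛ f L ⊛ p ≈ sumₛ (λ k → f k ⊛ p) L
sumₛ-⊛ f p zero    = ≈-refl
sumₛ-⊛ f p (suc L) = ≈-trans (⊛-distribʳ p (sumₛ f L) (f (suc L))) (+-congʳ (sumₛ-⊛ f p L))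

sumₛ-cong[] : ∀ f g L M → (∀ k → k ≤ L → f k ≈[ M ] g k) → sumₛ f L ≈[ M ] sumₛ g L
sumₛ-cong[] f g zero    M f≈g = f≈g 0 z≤n
sumₛ-cong[] f g (suc L) M f≈g =
  ⊕-cong[] (sumₛ-cong[] f g L M (λ k k≤L → f≈g k (ℕ.m≤n⇒m≤1+n k≤L))) (f≈g (suc L) ℕ.≤-refl)

tri : ℕ → ℕ
tri zero    = 0
tri (suc k) = suc k ℕ.+ tri k

tri-≥ : ∀ k → k ≤ tri k
tri-≥ zero    = z≤n
tri-≥ (suc k) = ℕ.m≤m+n (suc k) (tri k)

jacobiCoeff : ℕ → ℤ
jacobiCoeff k = -1ℤ ^ k * (1ℤ + + 2 * + k)

jacobiCoeff-recurrence : ∀ k →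
  ⟪ jacobiCoeff (suc (suc k)) ⟫ ≈ ⟪ - + 2 ⟫ ⊛ ⟪ jacobiCoeff (suc k) ⟫ ⊕ ⊖ ⟪ jacobiCoeff k ⟫
jacobiCoeff-recurrence k =
  ≈-trans (⟪⟫-cong (recurrence (-1ℤ ^ k) (+ k)))
          (≈-trans (λ { zero → refl ; (suc _) → refl }) (+-congʳ (⟪⟫-* (- + 2) (jacobiCoeff (suc k)))))
  where
  recurrence : ∀ s K → -1ℤ * (-1ℤ * s) * (1ℤ + + 2 * (1ℤ + (1ℤ + K)))
                     ≡ - + 2 * (-1ℤ * s * (1ℤ + + 2 * (1ℤ + K))) + - (s * (1ℤ + + 2 * K))
  recurrence = solve-∀
  ⟪⟫-cong : ∀ {a b} → a ≡ b → ⟪ a ⟫ ≈ ⟪ b ⟫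
  ⟪⟫-cong refl = ≈-refl

gaussOdd : ℕ → ℕ → Series
gaussOdd n k = gauss (suc (n ℕ.+ n)) (suc (n ℕ.+ k))

gaussOdd-pascal : ∀ n k → k ≤ suc n →
  gaussOdd (suc n) k ≈ q^ (suc (n ℕ.+ n) ∸ (n ℕ.+ k)) ⊛ gauss (suc (n ℕ.+ n)) (n ℕ.+ k)
                     ⊕ (𝟙 ⊕ q^ (suc (suc (n ℕ.+ n)))) ⊛ gaussOdd n k
                     ⊕ q^ (suc (suc (n ℕ.+ k))) ⊛ gauss (suc (n ℕ.+ n)) (suc (suc (n ℕ.+ k)))
gaussOdd-pascal n k k≤1+n = begin
    gauss (suc (suc (n ℕ.+ suc n))) (suc J)
  ≈⟨ (λ m → cong (λ x → gauss (suc (suc x)) (suc J) m) (ℕ.+-suc n n)) ⟩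
    gauss (suc (suc N)) (suc J)
  ≈⟨ gauss-pascal′ (suc N) J ⟩
    q^ a ⊛ (gauss N (n ℕ.+ k) ⊕ q^ J ⊛ gauss N J) ⊕ (gauss N J ⊕ q^ (suc J) ⊛ gauss N (suc J))
  ≈⟨ solve 6 (λ qa b qj b′ qj′ b″ → qa :* (b :+ qj :* b′) :+ (b′ :+ qj′ :* b″)
                                  := qa :* b :+ (con 1ℤ :+ qa :* qj) :* b′ :+ qj′ :* b″)
       ≈-refl (q^ a) (gauss N (n ℕ.+ k)) (q^ J) (gauss N J) (q^ (suc J)) (gauss N (suc J)) ⟩
    q^ a ⊛ gauss N (n ℕ.+ k) ⊕ (𝟙 ⊕ q^ a ⊛ q^ J) ⊛ gauss N J ⊕ q^ (suc J) ⊛ gauss N (suc J)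
  ≈⟨ +-congʳ (+-congˡ {x = q^ a ⊛ gauss N (n ℕ.+ k)} (*-congʳ (+-congˡ {x = 𝟙} (≈-sym q^[1+N])))) ⟩
    q^ a ⊛ gauss N (n ℕ.+ k) ⊕ (𝟙 ⊕ q^ (suc N)) ⊛ gauss N J ⊕ q^ (suc J) ⊛ gauss N (suc J) ∎
  where
  open ≈-Reasoning
  N = suc (n ℕ.+ n)
  J = suc (n ℕ.+ k)
  a = N ∸ (n ℕ.+ k)
  n+k≤N : n ℕ.+ k ≤ N
  n+k≤N = ℕ.≤-trans (ℕ.+-monoʳ-≤ n k≤1+n) (ℕ.≤-reflexive (ℕ.+-suc n n))
  q^[1+N] : q^ (suc N) ≈ q^ a ⊛ q^ J
  q^[1+N] = ≈-trans (q^-cong (sym (trans (ℕ.+-suc a (n ℕ.+ k)) (cong suc (ℕ.m∸n+n≡m n+k≤N))))) (q^-+ a J)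

term : ℕ → ℕ → Series
term n k = q^ (tri k) ⊛ gaussOdd n k

-- term n (k - 1), where term n (-1) = q⁰ [2n+1, n]_q equals term n 0 by symmetry.
termPrev : ℕ → ℕ → Series
termPrev n zero    = term n 0
termPrev n (suc k) = term n k

tri-exponent : ∀ n j → j ≤ n → tri (suc j) ℕ.+ (suc (n ℕ.+ n) ∸ (n ℕ.+ suc j)) ≡ suc n ℕ.+ tri j
tri-exponent n j j≤n = begin
    suc j ℕ.+ tri j ℕ.+ (suc (n ℕ.+ n) ∸ (n ℕ.+ suc j))
  ≡⟨ cong (λ x → suc j ℕ.+ tri j ℕ.+ (suc (n ℕ.+ n) ∸ x)) (ℕ.+-suc n j) ⟩
    suc j ℕ.+ tri j ℕ.+ (n ℕ.+ n ∸ (n ℕ.+ j))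
  ≡⟨ cong (suc j ℕ.+ tri j ℕ.+_) (ℕ.[m+n]∸[m+o]≡n∸o n n j) ⟩
    suc j ℕ.+ tri j ℕ.+ (n ∸ j)
  ≡⟨ swap (suc j) (tri j) (n ∸ j) ⟩
    suc j ℕ.+ (n ∸ j) ℕ.+ tri j
  ≡⟨ cong (λ x → suc x ℕ.+ tri j) (ℕ.m+[n∸m]≡n j≤n) ⟩
    suc n ℕ.+ tri j ∎
  where
  open ≡.≡-Reasoning
  swap : ∀ a b c → a ℕ.+ b ℕ.+ c ≡ a ℕ.+ c ℕ.+ b
  swap = NatSolver.solve-∀

q^tri-⊛-lowerGauss : ∀ n k → k ≤ suc n →
  q^ (tri k) ⊛ (q^ (suc (n ℕ.+ n) ∸ (n ℕ.+ k)) ⊛ gauss (suc (n ℕ.+ n)) (n ℕ.+ k))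
    ≈ q^ (suc n) ⊛ termPrev n k
q^tri-⊛-lowerGauss n zero _ = begin
    𝟙 ⊛ (q^ (N ∸ (n ℕ.+ 0)) ⊛ gauss N (n ℕ.+ 0))
  ≈⟨ *-congˡ (⊛-cong (q^-cong exponent) (λ m → cong (λ x → gauss N x m) (ℕ.+-identityʳ n))) ⟩
    𝟙 ⊛ (q^ (suc n) ⊛ gauss N n)
  ≈⟨ *-congˡ (*-congˡ middle) ⟩
    𝟙 ⊛ (q^ (suc n) ⊛ gaussOdd n 0)
  ≈⟨ solve 2 (λ a b → con 1ℤ :* (a :* b) := a :* (con 1ℤ :* b)) ≈-refl (q^ (suc n)) (gaussOdd n 0) ⟩
    q^ (suc n) ⊛ (𝟙 ⊛ gaussOdd n 0) ∎
  where
  N = suc (n ℕ.+ n)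
  open ≈-Reasoning
  exponent : N ∸ (n ℕ.+ 0) ≡ suc n
  exponent = trans (cong (N ∸_) (ℕ.+-identityʳ n)) (ℕ.m+n∸n≡m (suc n) n)
  middle : gauss N n ≈ gaussOdd n 0
  middle = ≈-trans (≈-sym (gauss-middle-symmetric n))
                   (λ m → cong (λ x → gauss N (suc x) m) (sym (ℕ.+-identityʳ n)))
q^tri-⊛-lowerGauss n (suc j) (s≤s j≤n) = begin
    q^ (tri (suc j)) ⊛ (q^ (N ∸ (n ℕ.+ suc j)) ⊛ gauss N (n ℕ.+ suc j))
  ≈⟨ ⊛-assoc (q^ (tri (suc j))) _ _ ⟨
    (q^ (tri (suc j)) ⊛ q^ (N ∸ (n ℕ.+ suc j))) ⊛ gauss N (n ℕ.+ suc j)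
  ≈⟨ ⊛-cong q^-exponents (λ m → cong (λ x → gauss N x m) (ℕ.+-suc n j)) ⟩
    (q^ (suc n) ⊛ q^ (tri j)) ⊛ gaussOdd n j
  ≈⟨ ⊛-assoc (q^ (suc n)) (q^ (tri j)) (gaussOdd n j) ⟩
    q^ (suc n) ⊛ term n j ∎
  where
  N = suc (n ℕ.+ n)
  open ≈-Reasoning
  q^-exponents : q^ (tri (suc j)) ⊛ q^ (N ∸ (n ℕ.+ suc j)) ≈ q^ (suc n) ⊛ q^ (tri j)
  q^-exponents = ≈-trans (≈-sym (q^-+ (tri (suc j)) _))
                         (≈-trans (q^-cong (tri-exponent n j j≤n)) (q^-+ (suc n) (tri j)))

term-step : ∀ n k → k ≤ suc n →
  term (suc n) k ≈ (𝟙 ⊕ q^ (suc n) ⊛ q^ (suc n)) ⊛ term n k ⊕ q^ (suc n) ⊛ term n (suc k)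
                 ⊕ q^ (suc n) ⊛ termPrev n k
term-step n k k≤1+n = begin
    q^ (tri k) ⊛ gaussOdd (suc n) k
  ≈⟨ *-congˡ (gaussOdd-pascal n k k≤1+n) ⟩
    q^ (tri k) ⊛ (lower ⊕ M′ ⊛ gaussOdd n k ⊕ q^ c ⊛ upper)
  ≈⟨ solve 6 (λ t l m b qc u → t :* (l :+ m :* b :+ qc :* u) := t :* l :+ m :* (t :* b) :+ (t :* qc) :* u)
       ≈-refl (q^ (tri k)) lower M′ (gaussOdd n k) (q^ c) upper ⟩
    q^ (tri k) ⊛ lower ⊕ M′ ⊛ term n k ⊕ (q^ (tri k) ⊛ q^ c) ⊛ upper
  ≈⟨ +-cong (+-cong (q^tri-⊛-lowerGauss n k k≤1+n) (*-congʳ M′≈M))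
            (⊛-cong q^[tri+c] (λ m → cong (λ x → gauss N (suc x) m) (sym (ℕ.+-suc n k)))) ⟩
    q ⊛ termPrev n k ⊕ M ⊛ term n k ⊕ (q ⊛ q^ (tri (suc k))) ⊛ gaussOdd n (suc k)
  ≈⟨ solve 6 (λ qq p m t tt b → qq :* p :+ m :* t :+ (qq :* tt) :* b := m :* t :+ qq :* (tt :* b) :+ qq :* p)
       ≈-refl q (termPrev n k) M (term n k) (q^ (tri (suc k))) (gaussOdd n (suc k)) ⟩
    M ⊛ term n k ⊕ q ⊛ term n (suc k) ⊕ q ⊛ termPrev n k ∎
  where
  open ≈-Reasoning
  q = q^ (suc n)
  N = suc (n ℕ.+ n)
  M = 𝟙 ⊕ q ⊛ q
  M′ = 𝟙 ⊕ q^ (suc (suc (n ℕ.+ n)))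
  c = suc (suc (n ℕ.+ k))
  lower = q^ (N ∸ (n ℕ.+ k)) ⊛ gauss N (n ℕ.+ k)
  upper = gauss N (suc (suc (n ℕ.+ k)))
  M′≈M : M′ ≈ M
  M′≈M = +-congˡ {x = 𝟙} (≈-trans (q^-cong (cong suc (sym (ℕ.+-suc n n)))) (q^-+ (suc n) (suc n)))
  exponent : ∀ n k t → t ℕ.+ suc (suc (n ℕ.+ k)) ≡ suc n ℕ.+ (suc k ℕ.+ t)
  exponent = NatSolver.solve-∀
  q^[tri+c] : q^ (tri k) ⊛ q^ c ≈ q ⊛ q^ (tri (suc k))
  q^[tri+c] = ≈-trans (≈-sym (q^-+ (tri k) c))
                      (≈-trans (q^-cong (exponent n k (tri k))) (q^-+ (suc n) (tri (suc k))))

weightedTerms : ℕ → ℕ → Series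
weightedTerms n L = sumₛ (λ k → ⟪ jacobiCoeff k ⟫ ⊛ term n k) L

-- The partial sums telescope, thanks to the three-term recurrence of jacobiCoeff.
weightedTerms-step : ∀ n L → L ≤ suc n →
  weightedTerms (suc n) L ≈ (1-q^ (suc n) ⊛ 1-q^ (suc n)) ⊛ weightedTerms n L
    ⊕ q^ (suc n) ⊛ (⟪ jacobiCoeff L ⟫ ⊛ term n (suc L) ⊕ ⊖ (⟪ jacobiCoeff (suc L) ⟫ ⊛ term n L))
weightedTerms-step n zero 0≤1+n = begin
    w₀ ⊛ term (suc n) 0
  ≈⟨ *-congˡ (term-step n 0 0≤1+n) ⟩
    w₀ ⊛ ((𝟙 ⊕ q ⊛ q) ⊛ term n 0 ⊕ q ⊛ term n 1 ⊕ q ⊛ term n 0)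
  ≈⟨ solve 3 (λ q t₀ t₁ → con (jacobiCoeff 0) :* ((con 1ℤ :+ q :* q) :* t₀ :+ q :* t₁ :+ q :* t₀)
                         := (con 1ℤ :- q) :* (con 1ℤ :- q) :* (con (jacobiCoeff 0) :* t₀)
                            :+ q :* (con (jacobiCoeff 0) :* t₁ :- con (jacobiCoeff 1) :* t₀))
       ≈-refl q (term n 0) (term n 1) ⟩
    (1-q^ (suc n) ⊛ 1-q^ (suc n)) ⊛ weightedTerms n 0
      ⊕ q ⊛ (w₀ ⊛ term n 1 ⊕ ⊖ (⟪ jacobiCoeff 1 ⟫ ⊛ term n 0)) ∎
  where
  open ≈-Reasoning
  q = q^ (suc n)
  w₀ = ⟪ jacobiCoeff 0 ⟫
weightedTerms-step n (suc L) L<1+n = begin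
    weightedTerms (suc n) L ⊕ w₁ ⊛ term (suc n) (suc L)
  ≈⟨ +-cong (weightedTerms-step n L (ℕ.<⇒≤ L<1+n)) (*-congˡ (term-step n (suc L) L<1+n)) ⟩
    S² ⊛ weightedTerms n L ⊕ q ⊛ (w₀ ⊛ t₁ ⊕ ⊖ (w₁ ⊛ t₀))
      ⊕ w₁ ⊛ ((𝟙 ⊕ q ⊛ q) ⊛ t₁ ⊕ q ⊛ t₂ ⊕ q ⊛ t₀)
  ≈⟨ solve 7 (λ a₀ a₁ s q y₀ y₁ y₂ →
        (con 1ℤ :- q) :* (con 1ℤ :- q) :* s :+ q :* (a₀ :* y₁ :- a₁ :* y₀)
          :+ a₁ :* ((con 1ℤ :+ q :* q) :* y₁ :+ q :* y₂ :+ q :* y₀)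
        := (con 1ℤ :- q) :* (con 1ℤ :- q) :* (s :+ a₁ :* y₁)
             :+ q :* (a₁ :* y₂ :- (con (- + 2) :* a₁ :- a₀) :* y₁))
       ≈-refl w₀ w₁ (weightedTerms n L) q t₀ t₁ t₂ ⟩
    S² ⊛ weightedTerms n (suc L) ⊕ q ⊛ (w₁ ⊛ t₂ ⊕ ⊖ ((⟪ - + 2 ⟫ ⊛ w₁ ⊕ ⊖ w₀) ⊛ t₁))
  ≈⟨ +-congˡ {x = S² ⊛ weightedTerms n (suc L)}
       (*-congˡ (+-congˡ {x = w₁ ⊛ t₂} (-‿cong (*-congʳ (≈-sym (jacobiCoeff-recurrence L)))))) ⟩
    S² ⊛ weightedTerms n (suc L) ⊕ q ⊛ (w₁ ⊛ t₂ ⊕ ⊖ (⟪ jacobiCoeff (suc (suc L)) ⟫ ⊛ t₁)) ∎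
  where
  open ≈-Reasoning
  q = q^ (suc n)
  S² = 1-q^ (suc n) ⊛ 1-q^ (suc n)
  w₀ = ⟪ jacobiCoeff L ⟫
  w₁ = ⟪ jacobiCoeff (suc L) ⟫
  t₀ = term n L
  t₁ = term n (suc L)
  t₂ = term n (suc (suc L))

term-vanishes : ∀ n d → term n (suc n ℕ.+ d) ≈ 𝟘
term-vanishes n d =
  ≈-trans (*-congˡ (gauss-vanishes (suc (n ℕ.+ n)) _ (s≤s (ℕ.+-monoʳ-< n (s≤s (ℕ.m≤m+n n d))))))
          (⊛-zeroʳ (q^ (tri (suc n ℕ.+ d))))

weightedTerms-diagonal : ∀ n →
  weightedTerms (suc n) (suc n) ≈ (1-q^ (suc n) ⊛ 1-q^ (suc n)) ⊛ weightedTerms n n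
weightedTerms-diagonal n = begin
    weightedTerms (suc n) (suc n)
  ≈⟨ weightedTerms-step n (suc n) ℕ.≤-refl ⟩
    S² ⊛ (weightedTerms n n ⊕ w₁ ⊛ term n (suc n))
      ⊕ q^ (suc n) ⊛ (w₁ ⊛ term n (suc (suc n)) ⊕ ⊖ (w₂ ⊛ term n (suc n)))
  ≈⟨ +-cong (*-congˡ (+-congˡ {x = weightedTerms n n} (*-congˡ t₁≈0)))
            (*-congˡ (+-cong (*-congˡ t₂≈0) (-‿cong (*-congˡ t₁≈0)))) ⟩
    S² ⊛ (weightedTerms n n ⊕ w₁ ⊛ ⟪ 0ℤ ⟫) ⊕ q^ (suc n) ⊛ (w₁ ⊛ ⟪ 0ℤ ⟫ ⊕ ⊖ (w₂ ⊛ ⟪ 0ℤ ⟫))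
  ≈⟨ solve 5 (λ s v a b q → s :* (v :+ a :* con 0ℤ) :+ q :* (a :* con 0ℤ :- b :* con 0ℤ) := s :* v)
       ≈-refl S² (weightedTerms n n) w₁ w₂ (q^ (suc n)) ⟩
    S² ⊛ weightedTerms n n ∎
  where
  open ≈-Reasoning
  S² = 1-q^ (suc n) ⊛ 1-q^ (suc n)
  w₁ = ⟪ jacobiCoeff (suc n) ⟫
  w₂ = ⟪ jacobiCoeff (suc (suc n)) ⟫
  𝟘≈⟪0⟫ : 𝟘 ≈ ⟪ 0ℤ ⟫
  𝟘≈⟪0⟫ = λ { zero → refl ; (suc _) → refl }
  t₁≈0 : term n (suc n) ≈ ⟪ 0ℤ ⟫
  t₁≈0 = ≈-trans (λ m → cong (λ k → term n k m) (sym (ℕ.+-identityʳ (suc n))))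
                 (≈-trans (term-vanishes n 0) 𝟘≈⟪0⟫)
  t₂≈0 : term n (suc (suc n)) ≈ ⟪ 0ℤ ⟫
  t₂≈0 = ≈-trans (λ m → cong (λ k → term n k m) (ℕ.+-comm 1 (suc n)))
                 (≈-trans (term-vanishes n 1) 𝟘≈⟪0⟫)

finiteJacobi : ∀ n → weightedTerms n n ≈ euler n ⊛ euler n
finiteJacobi zero = begin
    ⟪ 1ℤ ⟫ ⊛ (𝟙 ⊛ (𝟙 ⊕ q^ 1 ⊛ 𝟘)) ≈⟨ ⊛-identityˡ _ ⟩
    𝟙 ⊛ (𝟙 ⊕ q^ 1 ⊛ 𝟘)             ≈⟨ ⊛-identityˡ _ ⟩
    𝟙 ⊕ q^ 1 ⊛ 𝟘                   ≈⟨ +-congˡ {x = 𝟙} (⊛-zeroʳ (q^ 1)) ⟩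
    𝟙 ⊕ 𝟘                          ≈⟨ (λ m → ℤ.+-identityʳ (𝟙 m)) ⟩
    𝟙                              ≈⟨ ⊛-identityˡ 𝟙 ⟨
    𝟙 ⊛ 𝟙                          ∎
  where open ≈-Reasoning
finiteJacobi (suc n) = begin
    weightedTerms (suc n) (suc n)
  ≈⟨ weightedTerms-diagonal n ⟩
    (1-q^ (suc n) ⊛ 1-q^ (suc n)) ⊛ weightedTerms n n
  ≈⟨ *-congˡ (finiteJacobi n) ⟩
    (1-q^ (suc n) ⊛ 1-q^ (suc n)) ⊛ (euler n ⊛ euler n)
  ≈⟨ solve 2 (λ e p → (e :* e) :* (p :* p) := (p :* e) :* (p :* e)) ≈-refl (1-q^ (suc n)) (euler n) ⟩
    euler (suc n) ⊛ euler (suc n) ∎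
  where open ≈-Reasoning

-- Jacobi's identity for the cube of the Euler product

euler-stable : ∀ j n → j ≤ n → euler n ≈[ suc j ] euler j
euler-stable j zero    z≤n = ≈[]-refl
euler-stable j (suc n) j≤1+n with ℕ.m≤n⇒m<n∨m≡n j≤1+n
... | inj₂ refl      = ≈[]-refl
... | inj₁ (s≤s j≤n) =
  ≈[]-trans (⊛-cong[] {f = euler n} ≈[]-refl (1-q^-≈[] (s≤s j≤n)))
            (≈[]-trans (≈⇒≈[] (⊛-identityʳ (euler n))) (euler-stable j n j≤n))

eulerTop-≈[] : ∀ N J L → L ℕ.+ J ≤ suc N → eulerTop N J ≈[ L ] 𝟙
eulerTop-≈[] N zero    L _        = ≈[]-refl
eulerTop-≈[] N (suc J) L L+J<1+N =
  ≈[]-trans (⊛-cong[] (1-q^-≈[] L≤N∸J) (eulerTop-≈[] N J L L+J≤1+N)) (≈⇒≈[] (⊛-identityˡ 𝟙))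
  where
  L+J≤1+N : L ℕ.+ J ≤ suc N
  L+J≤1+N = ℕ.≤-trans (ℕ.+-monoʳ-≤ L (ℕ.n≤1+n J)) L+J<1+N
  L≤N∸J : L ≤ N ∸ J
  L≤N∸J = ℕ.m+n≤o⇒m≤o∸n L (ℕ.≤-pred (≡.subst (_≤ suc N) (ℕ.+-suc L J) L+J<1+N))

gaussOdd-⊛-euler : ∀ n k → k ≤ n → gaussOdd n k ⊛ euler n ≈[ suc n ∸ k ] 𝟙
gaussOdd-⊛-euler n k k≤n = ≈[]-trans (≈[]-weaken (ℕ.m∸n≤m (suc n) k) (≈[]-sym lengthen))
  (≈[]-trans (≈⇒≈[] (gauss-⊛-euler (suc (n ℕ.+ n)) (suc (n ℕ.+ k))))
             (eulerTop-≈[] _ _ _ (ℕ.≤-reflexive exponents)))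
  where
  lengthen : gaussOdd n k ⊛ euler (suc (n ℕ.+ k)) ≈[ suc n ] gaussOdd n k ⊛ euler n
  lengthen = ⊛-cong[] ≈[]-refl (euler-stable n (suc (n ℕ.+ k)) (ℕ.≤-trans (ℕ.m≤m+n n k) (ℕ.n≤1+n _)))
  exponents : (suc n ∸ k) ℕ.+ suc (n ℕ.+ k) ≡ suc (suc (n ℕ.+ n))
  exponents = begin
      (suc n ∸ k) ℕ.+ suc (n ℕ.+ k)   ≡⟨ ℕ.+-suc (suc n ∸ k) (n ℕ.+ k) ⟩
      suc ((suc n ∸ k) ℕ.+ (n ℕ.+ k)) ≡⟨ cong suc (rearrange (suc n ∸ k) n k) ⟩
      suc (n ℕ.+ ((suc n ∸ k) ℕ.+ k)) ≡⟨ cong (λ x → suc (n ℕ.+ x)) (ℕ.m∸n+n≡m (ℕ.m≤n⇒m≤1+n k≤n)) ⟩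
      suc (n ℕ.+ suc n)               ≡⟨ cong suc (ℕ.+-suc n n) ⟩
      suc (suc (n ℕ.+ n))             ∎
    where
    open ≡.≡-Reasoning
    rearrange : ∀ a n k → a ℕ.+ (n ℕ.+ k) ≡ n ℕ.+ (a ℕ.+ k)
    rearrange = NatSolver.solve-∀

jacobiPartial : ℕ → Series
jacobiPartial n = sumₛ (λ k → ⟪ jacobiCoeff k ⟫ ⊛ q^ (tri k)) n

weightedTerms-⊛-euler : ∀ n → weightedTerms n n ⊛ euler n ≈[ suc n ] jacobiPartial n
weightedTerms-⊛-euler n = ≈[]-trans (≈⇒≈[] (sumₛ-⊛ _ (euler n) n)) (sumₛ-cong[] _ _ n (suc n) each-term)
  where
  each-term : ∀ k → k ≤ n →
              (⟪ jacobiCoeff k ⟫ ⊛ term n k) ⊛ euler n ≈[ suc n ] ⟪ jacobiCoeff k ⟫ ⊛ q^ (tri k)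
  each-term k k≤n = ≈[]-trans (≈⇒≈[] reassociate) (⊛-cong[] {f = w} ≈[]-refl truncate)
    where
    w = ⟪ jacobiCoeff k ⟫
    reassociate : (w ⊛ term n k) ⊛ euler n ≈ w ⊛ (q^ (tri k) ⊛ (gaussOdd n k ⊛ euler n))
    reassociate = ≈-trans (⊛-assoc w _ (euler n)) (*-congˡ (⊛-assoc (q^ (tri k)) (gaussOdd n k) (euler n)))
    bound : suc n ≤ tri k ℕ.+ (suc n ∸ k)
    bound = ℕ.≤-trans (ℕ.≤-reflexive (sym (ℕ.m+[n∸m]≡n (ℕ.m≤n⇒m≤1+n k≤n))))
                      (ℕ.+-monoˡ-≤ (suc n ∸ k) (tri-≥ k))
    truncate : q^ (tri k) ⊛ (gaussOdd n k ⊛ euler n) ≈[ suc n ] q^ (tri k)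
    truncate = ≈[]-trans (≈[]-weaken bound (q^-⊛-cong[] (tri k) (gaussOdd-⊛-euler n k k≤n)))
                         (≈⇒≈[] (⊛-identityʳ (q^ (tri k))))

-- Terms with k > m do not contribute to the coefficient of qᵐ, as tri k ≥ k.
jacobi : Series
jacobi m = sum≤ (λ k → jacobiCoeff k * (q^ (tri k)) m) m

jacobiPartial-≈[] : ∀ n → jacobiPartial n ≈[ suc n ] jacobi
jacobiPartial-≈[] n m (s≤s m≤n) = begin
    jacobiPartial n m
  ≡⟨ sumₛ-pointwise _ n m ⟩
    sum≤ (λ k → (⟪ jacobiCoeff k ⟫ ⊛ q^ (tri k)) m) n
  ≡⟨ sum≤-cong _ _ n (λ k _ → ⟪⟫-⊛ (jacobiCoeff k) (q^ (tri k)) m) ⟩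
    sum≤ h n
  ≡⟨ cong (sum≤ h) (ℕ.m+[n∸m]≡n m≤n) ⟨
    sum≤ h (m ℕ.+ (n ∸ m))
  ≡⟨ sum≤-extend h m (n ∸ m) beyond ⟩
    sum≤ h m ∎
  where
  open ≡.≡-Reasoning
  h : ℕ → ℤ
  h k = jacobiCoeff k * (q^ (tri k)) m
  beyond : ∀ k → m < k → h k ≡ 0ℤ
  beyond k m<k = ∙-q^-offDiagonal (jacobiCoeff k) (tri k) m (ℕ.<⇒≢ (ℕ.<-≤-trans m<k (tri-≥ k)))

cube : Series → Series
cube p = p ⊛ (p ⊛ p)

euler³-≈[] : ∀ n → cube (euler n) ≈[ suc n ] jacobi
euler³-≈[] n = ≈[]-trans (≈⇒≈[] (≈-trans (⊛-comm (euler n) _) (*-congʳ (≈-sym (finiteJacobi n)))))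
                 (≈[]-trans (weightedTerms-⊛-euler n) (jacobiPartial-≈[] n))

θ-cube : ∀ a p → θ p ≈ ⊖ (a ⊛ p) → θ (cube p) ≈ ⊖ (⟪ + 3 ⟫ ⊛ (a ⊛ cube p))
θ-cube a p θp≈ = begin
    θ (p ⊛ (p ⊛ p))
  ≈⟨ θ-⊛ p (p ⊛ p) ⟩
    θ p ⊛ (p ⊛ p) ⊕ p ⊛ θ (p ⊛ p)
  ≈⟨ +-cong (*-congʳ θp≈) (*-congˡ (≈-trans (θ-⊛ p p) (+-cong (*-congʳ θp≈) (*-congˡ θp≈)))) ⟩
    ⊖ (a ⊛ p) ⊛ (p ⊛ p) ⊕ p ⊛ (⊖ (a ⊛ p) ⊛ p ⊕ p ⊛ ⊖ (a ⊛ p))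
  ≈⟨ solve 2 (λ a p → (:- (a :* p)) :* (p :* p) :+ p :* ((:- (a :* p)) :* p :+ p :* (:- (a :* p)))
                      := :- (con (+ 3) :* (a :* (p :* (p :* p))))) ≈-refl a p ⟩
    ⊖ (⟪ + 3 ⟫ ⊛ (a ⊛ cube p)) ∎
  where open ≈-Reasoning

-- The coefficient of qᵐ only involves euler m, where both identities hold up to degree m.
θ-jacobi : θ jacobi ≈ ⊖ (⟪ + 3 ⟫ ⊛ (σ-series ⊛ jacobi))
θ-jacobi m = begin
    + m * jacobi m
  ≡⟨ cong (+ m *_) (euler³-≈[] m m ℕ.≤-refl) ⟨
    θ (cube (euler m)) m
  ≡⟨ θ-cube (σ≤ m) (euler m) (θ-euler m) m ⟩
    - (⟪ + 3 ⟫ ⊛ (σ≤ m ⊛ cube (euler m))) m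
  ≡⟨ cong -_ (⊛-cong[] {f = ⟪ + 3 ⟫} ≈[]-refl (⊛-cong[] (σ≤-≈[] m) (euler³-≈[] m)) m ℕ.≤-refl) ⟩
    - (⟪ + 3 ⟫ ⊛ (σ-series ⊛ jacobi)) m ∎
  where open ≡.≡-Reasoning

conv-helper-sum≤ : ∀ (s : Series) m (go : ℕ → ℤ → ℤ) →
  (∀ y → go 0 y ≡ + σ 1 * s m + y) →
  (∀ i y → go (suc i) y ≡ go i (+ σ (suc (suc i)) * s (m ∸ suc i)) + y) →
  ∀ i y → go i y ≡ sum≤ (λ k → + σ (suc k) * s (m ∸ k)) i + y
conv-helper-sum≤ s m go go-zero go-suc zero    y = go-zero y
conv-helper-sum≤ s m go go-zero go-suc (suc i) y =
  trans (go-suc i y) (cong (_+ y) (conv-helper-sum≤ s m go go-zero go-suc i _))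

-- The helper of conv is local to Defs and cannot be named: convHelper is left for unification
-- to fill in, from the goal of conv-sum≤, with that helper plus an accumulator.
conv-sum≤ : ∀ s n → conv s n ≡ sum≤ (λ k → + σ (suc k) * s (n ∸ k)) n
convHelper : Series → ℕ → ℕ → ℤ → ℤ
convHelper = λ s m i y → _
conv-sum≤ s zero    = refl
conv-sum≤ s (suc n) with suc n | + σ (suc (suc n)) * s (n ∸ n)
... | m | y = conv-helper-sum≤ s m (convHelper s m) (λ _ → refl) (λ _ _ → refl) n y

conv≡⊛ : ∀ s n → conv s n ≡ ((σ-series ∘ suc) ⊛ s) n
conv≡⊛ s n = trans (conv-sum≤ s n) (sym (⊛-sum≤ (σ-series ∘ suc) s n))

jacobi′ : Series
jacobi′ m = θ jacobi (suc m)

jacobi′-≈ : jacobi′ ≈ ⊖ (⟪ + 3 ⟫ ⊛ ((σ-series ∘ suc) ⊛ jacobi))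
jacobi′-≈ m = trans (θ-jacobi (suc m)) (cong -_ (begin
    (⟪ + 3 ⟫ ⊛ (σ-series ⊛ jacobi)) (suc m)
  ≡⟨ ⟪⟫-⊛ (+ 3) (σ-series ⊛ jacobi) (suc m) ⟩
    + 3 * (0ℤ * jacobi (suc m) + ((σ-series ∘ suc) ⊛ jacobi) m)
  ≡⟨ cong (+ 3 *_) (ℤ.+-identityˡ _) ⟩
    + 3 * ((σ-series ∘ suc) ⊛ jacobi) m
  ≡⟨ ⟪⟫-⊛ (+ 3) ((σ-series ∘ suc) ⊛ jacobi) m ⟨
    (⟪ + 3 ⟫ ⊛ ((σ-series ∘ suc) ⊛ jacobi)) m ∎))
  where open ≡.≡-Reasoning

⊛-jacobi′ : ∀ u → (σ-series ∘ suc) ⊛ u ≈ 𝟙 → ∀ n → (u ⊛ jacobi′) n ≡ - (+ 3 * jacobi n)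
⊛-jacobi′ u σ⊛u≈𝟙 n = trans (u⊛jacobi′ n) (cong -_ (⟪⟫-⊛ (+ 3) jacobi n))
  where
  open ≈-Reasoning
  u⊛jacobi′ : u ⊛ jacobi′ ≈ ⊖ (⟪ + 3 ⟫ ⊛ jacobi)
  u⊛jacobi′ = begin
      u ⊛ jacobi′
    ≈⟨ *-congˡ jacobi′-≈ ⟩
      u ⊛ ⊖ (⟪ + 3 ⟫ ⊛ ((σ-series ∘ suc) ⊛ jacobi))
    ≈⟨ solve 4 (λ c s j v → v :* (:- (c :* (s :* j))) := :- (c :* (j :* (s :* v))))
         ≈-refl ⟪ + 3 ⟫ (σ-series ∘ suc) jacobi u ⟩
      ⊖ (⟪ + 3 ⟫ ⊛ (jacobi ⊛ ((σ-series ∘ suc) ⊛ u)))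
    ≈⟨ -‿cong (*-congˡ (≈-trans (*-congˡ σ⊛u≈𝟙) (⊛-identityʳ jacobi))) ⟩
      ⊖ (⟪ + 3 ⟫ ⊛ jacobi) ∎

-- Congruences modulo 5

module _ where
  open import Data.Integer.Divisibility.Signed

  ∣-sum≤ : ∀ d h n → (∀ k → k ≤ n → d ∣ h k) → d ∣ sum≤ h n
  ∣-sum≤ d h zero    d∣h = d∣h 0 z≤n
  ∣-sum≤ d h (suc n) d∣h =
    ∣m∣n⇒∣m+n (∣-sum≤ d h n (λ k k≤n → d∣h k (ℕ.m≤n⇒m≤1+n k≤n))) (d∣h (suc n) ℕ.≤-refl)

  ∣-sum≤-except : ∀ d h n i → i ≤ n → (∀ k → k ≤ n → k ≢ i → d ∣ h k) → d ∣ sum≤ h n - h i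
  ∣-sum≤-except d h zero    zero z≤n _   = divides 0ℤ (ℤ.+-inverseʳ (h 0))
  ∣-sum≤-except d h (suc n) i i≤1+n d∣h with ℕ.m≤n⇒m<n∨m≡n i≤1+n
  ... | inj₂ refl = ≡.subst (d ∣_) (sym (cancel (sum≤ h n) (h (suc n))))
                      (∣-sum≤ d h n (λ k k≤n → d∣h k (ℕ.m≤n⇒m≤1+n k≤n) (ℕ.<⇒≢ (s≤s k≤n))))
    where
    cancel : ∀ a b → a + b - b ≡ a
    cancel = solve-∀
  ... | inj₁ (s≤s i≤n) = ≡.subst (d ∣_) (sym (swap (sum≤ h n) (h (suc n)) (h i)))
                           (∣m∣n⇒∣m+n earlier (d∣h (suc n) ℕ.≤-refl (≡.≢-sym (ℕ.<⇒≢ (s≤s i≤n)))))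
    where
    earlier = ∣-sum≤-except d h n i i≤n (λ k k≤n → d∣h k (ℕ.m≤n⇒m≤1+n k≤n))
    swap : ∀ a b c → a + b - c ≡ a - c + b
    swap = solve-∀

  5∣3x⇒5∣x : ∀ x → + 5 ∣ + 3 * x → + 5 ∣ x
  5∣3x⇒5∣x x 5∣3x =
    ≡.subst (+ 5 ∣_) (sym (two-thirds x)) (∣m∣n⇒∣m-n (∣n⇒∣m*n (+ 2) 5∣3x) (∣n⇒∣m*n x ∣-refl))
    where
    two-thirds : ∀ x → x ≡ + 2 * (+ 3 * x) - x * + 5
    two-thirds = solve-∀

  tri-+5 : ∀ k → tri (5 ℕ.+ k) ≡ tri k ℕ.+ (k ℕ.+ 3) ℕ.* 5
  tri-+5 k = unfold k (tri k)
    where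
    unfold : ∀ k t → 5 ℕ.+ k ℕ.+ (4 ℕ.+ k ℕ.+ (3 ℕ.+ k ℕ.+ (2 ℕ.+ k ℕ.+ (1 ℕ.+ k ℕ.+ t))))
                   ≡ t ℕ.+ (k ℕ.+ 3) ℕ.* 5
    unfold = NatSolver.solve-∀

  plus-multiple-of-5 : ∀ {a} m → 5 ℕ.∣ a → 5 ℕ.∣ a ℕ.+ m ℕ.* 5
  plus-multiple-of-5 m 5∣a = ℕ.∣m∣n⇒∣m+n 5∣a (ℕ.n∣m*n m)

  tri-mod5 : ∀ k → 5 ℕ.∣ tri k ⊎ 5 ℕ.∣ 4 ℕ.+ tri k ⊎ 5 ℕ.∣ 1 ℕ.+ 2 ℕ.* k
  tri-mod5 0 = inj₁ (ℕ.divides 0 refl)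
  tri-mod5 1 = inj₂ (inj₁ (ℕ.divides 1 refl))
  tri-mod5 2 = inj₂ (inj₂ (ℕ.divides 1 refl))
  tri-mod5 3 = inj₂ (inj₁ (ℕ.divides 2 refl))
  tri-mod5 4 = inj₁ (ℕ.divides 2 refl)
  tri-mod5 (suc (suc (suc (suc (suc k))))) with tri-mod5 k
  ... | inj₁ 5∣t        = inj₁ (≡.subst (5 ℕ.∣_) (sym (tri-+5 k)) (plus-multiple-of-5 (k ℕ.+ 3) 5∣t))
  ... | inj₂ (inj₁ 5∣t) =
    inj₂ (inj₁ (≡.subst (5 ℕ.∣_) (sym (cong (4 ℕ.+_) (tri-+5 k))) (plus-multiple-of-5 (k ℕ.+ 3) 5∣t)))
  ... | inj₂ (inj₂ 5∣o) = inj₂ (inj₂ (≡.subst (5 ℕ.∣_) (sym (odd-+5 k)) (plus-multiple-of-5 2 5∣o)))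
    where
    odd-+5 : ∀ k → 1 ℕ.+ 2 ℕ.* (5 ℕ.+ k) ≡ 1 ℕ.+ 2 ℕ.* k ℕ.+ 2 ℕ.* 5
    odd-+5 = NatSolver.solve-∀

  5∣jacobiCoeff : ∀ k → 5 ℕ.∣ 1 ℕ.+ 2 ℕ.* k → + 5 ∣ jacobiCoeff k
  5∣jacobiCoeff k 5∣o = ∣n⇒∣m*n (-1ℤ ^ k) (≡.subst (+ 5 ∣_) pos-odd (∣ᵤ⇒∣ 5∣o))
    where
    pos-odd : + (1 ℕ.+ 2 ℕ.* k) ≡ 1ℤ + + 2 * + k
    pos-odd = trans (ℤ.pos-+ 1 (2 ℕ.* k)) (cong (_+_ 1ℤ) (ℤ.pos-* 2 k))

  jacobi-mod5 : ∀ m → 5 ℕ.∣ m ⊎ 5 ℕ.∣ 4 ℕ.+ m ⊎ + 5 ∣ jacobi m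
  jacobi-mod5 m with 5 ℕ.∣? m | 5 ℕ.∣? 4 ℕ.+ m
  ... | yes 5∣m | _         = inj₁ 5∣m
  ... | no _    | yes 5∣4+m = inj₂ (inj₁ 5∣4+m)
  ... | no 5∤m  | no 5∤4+m  = inj₂ (inj₂ (∣-sum≤ (+ 5) _ m each-term))
    where
    each-term : ∀ k → k ≤ m → + 5 ∣ jacobiCoeff k * (q^ (tri k)) m
    each-term k _ with tri k ℕ.≟ m
    ... | no tri≢m = divides 0ℤ (∙-q^-offDiagonal (jacobiCoeff k) (tri k) m (tri≢m ∘ sym))
    ... | yes refl with tri-mod5 k
    ...   | inj₁ 5∣t        = contradiction 5∣t 5∤m
    ...   | inj₂ (inj₁ 5∣t) = contradiction 5∣t 5∤4+m
    ...   | inj₂ (inj₂ 5∣o) = ∣m⇒∣m*n _ (5∣jacobiCoeff k 5∣o)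

  5∣jacobi′ : ∀ m → ¬ 5 ℕ.∣ m → + 5 ∣ jacobi′ m
  5∣jacobi′ m 5∤m with jacobi-mod5 (suc m)
  ... | inj₁ 5∣1+m        = ∣m⇒∣m*n (jacobi (suc m)) (∣ᵤ⇒∣ {+ 5} {+ suc m} 5∣1+m)
  ... | inj₂ (inj₁ 5∣5+m) = contradiction (ℕ.∣m+n∣m⇒∣n 5∣5+m ℕ.∣-refl) 5∤m
  ... | inj₂ (inj₂ 5∣J)   = ∣n⇒∣m*n (+ suc m) 5∣J

  5∣pred*jacobi : ∀ m → ¬ 5 ℕ.∣ suc m → + 5 ∣ + m * jacobi (suc m)
  5∣pred*jacobi m 5∤1+m with jacobi-mod5 (suc m)
  ... | inj₁ 5∣1+m        = contradiction 5∣1+m 5∤1+m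
  ... | inj₂ (inj₁ 5∣5+m) =
    ∣m⇒∣m*n (jacobi (suc m)) (∣ᵤ⇒∣ {+ 5} {+ m} (ℕ.∣m+n∣m⇒∣n 5∣5+m ℕ.∣-refl))
  ... | inj₂ (inj₂ 5∣J)   = ∣n⇒∣m*n (+ m) 5∣J

  isolate-3u : ∀ S U J M → - (+ 3 * J) ≡ S + U * - + 3 →
               + 3 * U ≡ (S - - + 3 * ((1ℤ + M) * J)) - + 3 * (M * J)
  isolate-3u S U J M eq = begin
      + 3 * U                                 ≡⟨ rearrange S U J M ⟩
      R + (- (+ 3 * J) - (S + U * - + 3))     ≡⟨ cong (λ x → R + (x - (S + U * - + 3))) eq ⟩
      R + ((S + U * - + 3) - (S + U * - + 3)) ≡⟨ cong (_+_ R) (ℤ.+-inverseʳ (S + U * - + 3)) ⟩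
      R + 0ℤ                                  ≡⟨ ℤ.+-identityʳ R ⟩
      R                                       ∎
    where
    open ≡.≡-Reasoning
    R = (S - - + 3 * ((1ℤ + M) * J)) - + 3 * (M * J)
    rearrange : ∀ S U J M → + 3 * U ≡ (S - - + 3 * ((1ℤ + M) * J)) - + 3 * (M * J)
                                      + (- (+ 3 * J) - (S + U * - + 3))
    rearrange = solve-∀

  module _ (u : Series) (u-inverse : ∀ n → conv u n ≡ δ n) where

    σ⊛u≈𝟙 : (σ-series ∘ suc) ⊛ u ≈ 𝟙
    σ⊛u≈𝟙 n = trans (sym (conv≡⊛ u n)) (trans (u-inverse n) (δ≡𝟙 n))
      where
      δ≡𝟙 : ∀ n → δ n ≡ 𝟙 n
      δ≡𝟙 zero    = refl
      δ≡𝟙 (suc _) = refl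

    u-one : u 1 ≡ - + 3
    u-one = begin
        u 1                                     ≡⟨ isolate (u 1) (u 0) ⟩
        (+ 1 * u 1 + + 3 * u 0) + - (+ 3 * u 0) ≡⟨ cong₂ (λ a b → a + - (+ 3 * b)) (u-inverse 1) u-zero ⟩
        - + 3                                   ∎
      where
      open ≡.≡-Reasoning
      isolate : ∀ a b → a ≡ (+ 1 * a + + 3 * b) + - (+ 3 * b)
      isolate = solve-∀
      u-zero : u 0 ≡ 1ℤ
      u-zero = trans (sym (ℤ.*-identityˡ (u 0))) (u-inverse 0)

    -- In the coefficient of qⁿ in u ⊛ jacobi′ = -3 jacobi, every term is divisible by 5 except the
    -- one with u n (as jacobi′ 0 = -3) and the one with u 1 = -3, which combines with -3 jacobi n.
    u-mod5-step : ∀ n → (∀ {j} → j < n → 1 < j → ¬ 5 ℕ.∣ j → + 5 ∣ u j) →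
                  1 < n → ¬ 5 ℕ.∣ n → + 5 ∣ u n
    u-mod5-step (suc m) ih (s≤s 1≤m) 5∤n = 5∣3x⇒5∣x (u n)
      (≡.subst (+ 5 ∣_) (sym 3u≡) (∣m∣n⇒∣m-n others (∣n⇒∣m*n (+ 3) (5∣pred*jacobi m 5∤n))))
      where
      n = suc m
      h : ℕ → ℤ
      h j = u j * jacobi′ (n ∸ j)
      1<j : ∀ j → ¬ 5 ℕ.∣ j → j ≢ 1 → 1 < j
      1<j zero          5∤0 _   = contradiction (5 ℕ.∣0) 5∤0
      1<j (suc zero)    _   1≢1 = contradiction refl 1≢1
      1<j (suc (suc _)) _   _   = s≤s (s≤s z≤n)
      each-term : ∀ j → j ≤ m → j ≢ 1 → + 5 ∣ h j
      each-term j j≤m j≢1 with 5 ℕ.∣? j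
      ... | yes 5∣j = ∣n⇒∣m*n (u j) (5∣jacobi′ (n ∸ j) λ 5∣n∸j →
                        5∤n (≡.subst (5 ℕ.∣_) (ℕ.m∸n+n≡m (ℕ.m≤n⇒m≤1+n j≤m))
                                     (ℕ.∣m∣n⇒∣m+n 5∣n∸j 5∣j)))
      ... | no 5∤j  = ∣m⇒∣m*n _ (ih (s≤s j≤m) (1<j j 5∤j j≢1) 5∤j)
      others : + 5 ∣ sum≤ h m - h 1
      others = ∣-sum≤-except (+ 5) h m 1 1≤m each-term
      coefficient : - (+ 3 * jacobi n) ≡ sum≤ h m + u n * - + 3
      coefficient = trans (sym (⊛-jacobi′ u σ⊛u≈𝟙 n)) (trans (⊛-sum≤ u jacobi′ n)
                          (cong (λ k → sum≤ h m + u n * jacobi′ k) (ℕ.n∸n≡0 m)))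
      3u≡ : + 3 * u n ≡ (sum≤ h m - h 1) - + 3 * (+ m * jacobi n)
      3u≡ = trans (isolate-3u (sum≤ h m) (u n) (jacobi n) (+ m) coefficient)
                  (cong (λ x → (sum≤ h m - x * jacobi′ m) - + 3 * (+ m * jacobi n)) (sym u-one))

    u-mod5 : ∀ n → 1 < n → ¬ 5 ℕ.∣ n → + 5 ∣ u n
    u-mod5 = <-rec (λ n → 1 < n → ¬ 5 ℕ.∣ n → + 5 ∣ u n) u-mod5-step

open import Data.Integer.Divisibility using (_∣_)

proposition5p3 : (σinv : ℕ → ℤ) → (∀ n → conv σinv n ≡ δ n) →
    ∀ n → 1 < n → n % 5 ≢ 0 → + 5 ∣ σinv n
proposition5p3 σinv σinv-inverse n 1<n n%5≢0 =
  Signed.∣⇒∣ᵤ (u-mod5 σinv σinv-inverse n 1<n (n%5≢0 ∘ ℕ.n∣m⇒m%n≡0 n 5))
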